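{- Let $\bm\lambda=(R_1,\dots,R_n)$ be a minimal noncommuting path with $l(R_1)<l(R_n)$ and $R_1\nleftrightarrow R_n$, and suppose that the pairs $(R_t,R_{t+1})$ are not strict for $1\le t\le n-1$. Then one of the following holds: (1) one of the sequences $(R_1,\dots,R_{n-1})$, $(R_2,\dots,R_{n-1})$, or $(R_2,\dots,R_n)$ is a strict sequence of $\bm\lambda$; (2) $n=4$, $l(R_2)=l(R_4)=r(R_1)+1=r(R_3)+1$, $R_4\precnsim R_2$, and $R_1\precnsim R_3$.
   Context: A row is $R=a/b=\{(1,j):b+1\le j\le a\}$ ($a\ge b\ge0$ integers); $l(R)=b$, $r(R)=a-1$, $|R|$ its number of cells, $R^+=(a+1)/(b+1)$. For rows $R,R'$: $M(R,R')=|R\cap R'|$ if $l(R)\le l(R')$, else $|R\cap R'^+|$. Rows commute, $R\leftrightarrow R'$, if $M(R,R')=M(R',R)$, else $R\nleftrightarrow R'$. For a sequence of rows $(R_1,\dots,R_n)$: $M_{i,j}=M(R_{\min(i,j)},R_{\max(i,j)})$; $R_i\prec R_j$ means $M_{i,j}=|R_i|$; $R_i\precnsim R_j$ means $R_i\prec R_j$ but not $R_j\prec R_i$. A noncommuting path is a sequence of $n\ge3$ rows with $R_t\nleftrightarrow R_{t+1}$ for all $t$; it is minimal if no subsequence $(R_1=R_{i_1},\dots,R_{i_k}=R_n)$, $i_1<\dots<i_k$, $3\le k<n$, is a noncommuting path. A pair $(R_i,R_j)$ with $i<j$ and $l(R_i)<l(R_j)$ is strict if either $0<M_{i,j}<\min\{|R_i|,|R_j|\}$,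 or $M_{i,j}=0$ and $M_{i,k}+M_{j,k}\ge|R_k|+1$ for some $k\notin\{i,j\}$. A strict sequence is a sequence $(R_{j_1},\dots,R_{j_k})$ with $k\ge2$, $j_1<\dots<j_k$, $M_{j_t,j_{t'}}=0$ for all $t<t'$, and some $h$ with $h<j_1$ or $h>j_k$ such that $M_{j_t,h}>0$ for all $t$ and $\sum_tM_{j_t,h}\ge|R_h|+1$. -}

module Defs where

open import Data.Nat as ℕ using (ℕ; zero; suc; _+_; _∸_; _⊓_; _⊔_; _≤_; _<_; _≤?_)
open import Data.Integer as ℤ using (ℤ; +_)
open import Data.Fin as Fin using (Fin; toℕ)
open import Data.Bool using (if_then_else_)
open import Data.List using (List; []; _∷_; length; map; tabulate; allFin; filter; head; last)
open import Data.Nat.ListAction using (sum)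
open import Data.List.Relation.Unary.All using (All)
open import Data.List.Relation.Unary.AllPairs using (AllPairs)
open import Data.List.Relation.Unary.Linked using (Linked)
open import Data.Maybe as Maybe using (Maybe; just)
open import Data.Product using (_×_; Σ; ∃)
open import Data.Sum using (_⊎_)
open import Data.Empty using (⊥)
open import Relation.Nullary using (¬_; does)
open import Relation.Nullary.Decidable using (_×-dec_)
open import Relation.Binary.PropositionalEquality using (_≡_; _≢_)

-- A row a/b = {(1,j) : b+1 ≤ j ≤ a}, with a ≥ b ≥ 0.
record Row : Set where
  constructor _/_[_]
  field
    a : ℕ
    b : ℕ
    b≤a : b ≤ a
open Row public

l : Row → ℕ
l R = b R

-- r(R) = a - 1, as an integer (it is -1 for the empty row 0/0)
r : Row → ℤ
r R = (+ a R) ℤ.- ℤ.1ℤ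

∣_∣ʳ : Row → ℕ
∣ R ∣ʳ = a R ∸ b R

∣_∩_∣ : Row → Row → ℕ
∣ R ∩ R' ∣ = (a R ⊓ a R') ∸ (b R ⊔ b R')

_⁺ : Row → Row
(x / y [ p ]) ⁺ = suc x / suc y [ ℕ.s≤s p ]

M : Row → Row → ℕ
M R R' = if does (l R ≤? l R') then ∣ R ∩ R' ∣ else ∣ R ∩ (R' ⁺) ∣

Commute : Row → Row → Set
Commute R R' = M R R' ≡ M R' R

NCPath : List Row → Set
NCPath Rs = (3 ≤ length Rs) × Linked (λ R R' → ¬ Commute R R') Rs

module _ {n : ℕ} (R : Fin n → Row) where

  Mˢ : Fin n → Fin n → ℕ
  Mˢ i j = if does (toℕ i ≤? toℕ j) then M (R i) (R j) else M (R j) (R i)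

  Prec : Fin n → Fin n → Set
  Prec i j = Mˢ i j ≡ ∣ R i ∣ʳ

  PrecStrict : Fin n → Fin n → Set
  PrecStrict i j = Prec i j × ¬ Prec j i

  -- minimality: no index subsequence i₁ < … < i_k with i₁ = 1, i_k = n (1-based),
  -- 3 ≤ k < n, gives a noncommuting path
  Minimal : Set
  Minimal = (js : List (Fin n)) → Linked Fin._<_ js →
            Maybe.map toℕ (head js) ≡ just 0 →
            Maybe.map toℕ (last js) ≡ just (n ∸ 1) →
            3 ≤ length js → length js < n →
            ¬ NCPath (map R js)

  StrictPair : Fin n → Fin n → Set
  StrictPair i j =
    (i Fin.< j) × (l (R i) < l (R j)) ×
    ( ((0 < Mˢ i j) × (Mˢ i j < ∣ R i ∣ʳ ⊓ ∣ R j ∣ʳ))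
    ⊎ ((Mˢ i j ≡ 0) × ∃ λ k → (k ≢ i) × (k ≢ j) × (∣ R k ∣ʳ + 1 ≤ Mˢ i k + Mˢ j k)))

  StrictSeq : List (Fin n) → Set
  StrictSeq js =
    Linked Fin._<_ js × (2 ≤ length js) ×
    AllPairs (λ s t → Mˢ s t ≡ 0) js ×
    ∃ λ h → (All (λ j → h Fin.< j) js ⊎ All (λ j → j Fin.< h) js) ×
            All (λ j → 0 < Mˢ j h) js ×
            (∣ R h ∣ʳ + 1 ≤ sum (map (λ j → Mˢ j h) js))

-- indices (0-based) p..q in increasing order, i.e. (R_{p+1},…,R_{q+1}) in 1-based terms
range : (n p q : ℕ) → List (Fin n)
range n p q = filter (λ i → (p ≤? toℕ i) ×-dec (toℕ i ≤? q)) (allFin n)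

-- Alternative (2) of the proposition, for a sequence of n rows (0-based indices)
Case2 : (n : ℕ) → (Fin n → Row) → Set
Case2 4 R =
  let 0F : Fin 4 ; 0F = Fin.zero ; 1F : Fin 4 ; 1F = Fin.suc Fin.zero ; 2F : Fin 4 ; 2F = Fin.suc (Fin.suc Fin.zero) ; 3F : Fin 4 ; 3F = Fin.suc (Fin.suc (Fin.suc Fin.zero)) in
  (l (R 1F) ≡ l (R 3F)) × ((+ l (R 3F)) ≡ r (R 0F) ℤ.+ ℤ.1ℤ) ×
  (r (R 0F) ℤ.+ ℤ.1ℤ ≡ r (R 2F) ℤ.+ ℤ.1ℤ) ×
  PrecStrict R 3F 1F × PrecStrict R 0F 2F
Case2 _ R = ⊥

-- Two rows fail to commute exactly when one crosses the other: R starts strictly before S,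
-- S starts at the latest right after the end of R, and S ends strictly after R.  Call the edge
-- (R_t, R_{t+1}) an ascent if l(R_t) < l(R_{t+1}) and a descent otherwise.  By minimality no
-- two non-consecutive rows cross, except R_1 and R_n; as the ascents are not strict, the rows
-- of an ascent are adjacent (a_t = b_{t+1}) and never cover a third row with a cell to spare.
-- Nesting propagates along ascending runs, and this leaves room for exactly one descent.  A
-- descent at either end leaves a run of adjacent rows tiling R_1 resp. R_n with one extra
-- cell, i.e. a strict sequence; an inner descent forces n = 4 and the configuration of
-- alternative (2).

module Submission where

open import Defs
open import Data.Nat using (ℕ; suc; _∸_; _<_)
open import Data.Fin using (Fin; zero; fromℕ; toℕ)
open import Data.List using (tabulate)
open import Data.Sum using (_⊎_)
open import Relation.Nullary using (¬_)
open import Relation.Binary.PropositionalEquality using (_≡_)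

open import Data.Nat using (zero; _+_; _⊓_; _⊔_; _≤_; _≤?_; _<?_; _≟_; z≤n; s≤s; z<s)
open import Data.Nat.Properties
open import Data.Nat.ListAction using (sum)
open import Data.Nat.ListAction.Properties using (sum-++)
import Data.Integer as ℤ
import Data.Integer.Properties as ℤ
import Data.Fin as Fin
open import Data.Fin using (fromℕ<)
open import Data.Fin.Properties using (toℕ-fromℕ<; toℕ-fromℕ; toℕ-injective; toℕ<n)
open import Data.Bool using (if_then_else_)
open import Data.Product using (∃; _×_; _,_; proj₁; proj₂)
open import Data.Sum using (inj₁; inj₂; map₂)
open import Data.Empty using (⊥; ⊥-elim)
open import Data.Maybe as Maybe using (just)
open import Data.Maybe.Relation.Binary.Connected using (Connected; just)
open import Data.List using (List; []; _∷_; [_]; _++_; map; allFin; filter; length; last)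
open import Data.List.Properties
  using (map-∘; map-cong-local; tabulate-cong; length-map; length-++; filter-all; filter-none; filter-++; ++-identityʳ; map-++)
open import Data.List.Relation.Unary.All as All using (All; []; _∷_)
import Data.List.Relation.Unary.All.Properties as All
open import Data.List.Relation.Unary.AllPairs using (AllPairs; []; _∷_)
import Data.List.Relation.Unary.AllPairs.Properties as AllPairs
open import Data.List.Relation.Unary.Linked using (Linked; []; [-]; _∷_)
import Data.List.Relation.Unary.Linked.Properties as Linked
open import Function using (_∘_)
open import Relation.Nullary using (¬?; Dec; does; yes; no)
open import Relation.Nullary.Decidable using (dec-true; dec-false; decidable-stable; _⊎-dec_; _×-dec_)
open import Relation.Unary using (Decidable)
open import Relation.Binary.PropositionalEquality hiding ([_])
open import Relation.Binary.Definitions using (tri<; tri≈; tri>)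

private variable
  R S : Row
  x y w : ℕ

-- Rows

M-≤ : ∀ R S → l R ≤ l S → M R S ≡ a R ⊓ a S ∸ b S
M-≤ R S p = begin
  M R S                   ≡⟨ cong (λ c → if c then ∣ R ∩ S ∣ else ∣ R ∩ S ⁺ ∣) (dec-true (b R ≤? b S) p) ⟩
  a R ⊓ a S ∸ (b R ⊔ b S) ≡⟨ cong (a R ⊓ a S ∸_) (m≤n⇒m⊔n≡n p) ⟩
  a R ⊓ a S ∸ b S         ∎
  where open ≡-Reasoning

M-> : ∀ R S → l S < l R → M R S ≡ a R ⊓ suc (a S) ∸ b R
M-> R S p = begin
  M R S
    ≡⟨ cong (λ c → if c then ∣ R ∩ S ∣ else ∣ R ∩ S ⁺ ∣) (dec-false (b R ≤? b S) (<⇒≱ p)) ⟩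
  a R ⊓ suc (a S) ∸ (b R ⊔ suc (b S)) ≡⟨ cong (a R ⊓ suc (a S) ∸_) (m≥n⇒m⊔n≡m p) ⟩
  a R ⊓ suc (a S) ∸ b R               ∎
  where open ≡-Reasoning

M-≤-≤ : ∀ R S → l R ≤ l S → a R ≤ a S → M R S ≡ a R ∸ b S
M-≤-≤ R S b≤b′ a≤a′ = trans (M-≤ R S b≤b′) (cong (_∸ b S) (m≤n⇒m⊓n≡m a≤a′))

M->-> : ∀ R S → l S < l R → a S < a R → M R S ≡ suc (a S) ∸ b R
M->-> R S b′<b a′<a = trans (M-> R S b′<b) (cong (_∸ b R) (m≥n⇒m⊓n≡n a′<a))

-- b S ≤ a R admits rows that merely touch; they do not commute either, since M S R sees R⁺.
record Crosses (R S : Row) : Set where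
  constructor crossing
  field
    b<b′ : b R < b S
    b′≤a : b S ≤ a R
    a<a′ : a R < a S
open Crosses public

crosses⇒¬commute : Crosses R S → ¬ Commute R S
crosses⇒¬commute {R} {S} (crossing b<b′ b′≤a a<a′) commute = <-irrefl refl (begin-strict
  M R S           ≡⟨ M-≤-≤ R S (<⇒≤ b<b′) (<⇒≤ a<a′) ⟩
  a R ∸ b S       <⟨ ∸-monoˡ-< (n<1+n (a R)) b′≤a ⟩
  suc (a R) ∸ b S ≡⟨ M->-> S R b<b′ a<a′ ⟨
  M S R           ≡⟨ commute ⟨
  M R S           ∎)
  where open ≤-Reasoning

¬commute⇒crosses : l R < l S → ¬ Commute R S → Crosses R S
¬commute⇒crosses {R} {S} b<b′ ¬commute with a R <? a S | b S ≤? a R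
... | yes a<a′ | yes b′≤a = crossing b<b′ b′≤a a<a′
... | no a≮a′ | _ = ⊥-elim (¬commute (begin
  M R S                 ≡⟨ M-≤ R S (<⇒≤ b<b′) ⟩
  a R ⊓ a S ∸ b S       ≡⟨ cong (_∸ b S) (m≥n⇒m⊓n≡n (≮⇒≥ a≮a′)) ⟩
  a S ∸ b S             ≡⟨ cong (_∸ b S) (m≤n⇒m⊓n≡m (m≤n⇒m≤1+n (≮⇒≥ a≮a′))) ⟨
  a S ⊓ suc (a R) ∸ b S ≡⟨ M-> S R b<b′ ⟨
  M S R                 ∎))
  where open ≡-Reasoning
... | yes a<a′ | no b′≰a = ⊥-elim (¬commute (begin
  M R S                 ≡⟨ M-≤ R S (<⇒≤ b<b′) ⟩
  a R ⊓ a S ∸ b S       ≡⟨ m≤n⇒m∸n≡0 (≤-trans (m⊓n≤m (a R) (a S)) (<⇒≤ (≰⇒> b′≰a))) ⟩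
  0                     ≡⟨ m≤n⇒m∸n≡0 (≤-trans (m⊓n≤n (a S) (suc (a R))) (≰⇒> b′≰a)) ⟨
  a S ⊓ suc (a R) ∸ b S ≡⟨ M-> S R b<b′ ⟨
  M S R                 ∎))
  where open ≡-Reasoning

¬commute⇒crosses⊎crosses : ¬ Commute R S → Crosses R S ⊎ Crosses S R
¬commute⇒crosses⊎crosses {R} {S} ¬commute with <-cmp (b R) (b S)
... | tri< b<b′ _ _ = inj₁ (¬commute⇒crosses b<b′ ¬commute)
... | tri> _ _ b′<b = inj₂ (¬commute⇒crosses b′<b (λ commute → ¬commute (sym commute)))
... | tri≈ _ b≡b′ _ = ⊥-elim (¬commute (begin
  M R S           ≡⟨ M-≤ R S (≤-reflexive b≡b′) ⟩
  a R ⊓ a S ∸ b S ≡⟨ cong₂ _∸_ (⊓-comm (a R) (a S)) (sym b≡b′) ⟩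
  a S ⊓ a R ∸ b R ≡⟨ M-≤ S R (≤-reflexive (sym b≡b′)) ⟨
  M S R           ∎))
  where open ≡-Reasoning

record _⊑_ (R S : Row) : Set where
  constructor nested
  field
    b′≤b : b S ≤ b R
    a≤a′ : a R ≤ a S
open _⊑_ public

M-⊑ : ∀ R S → R ⊑ S → M R S ≡ ∣ R ∣ʳ
M-⊑ R S (nested b′≤b a≤a′) with b R ≤? b S
... | yes b≤b′ = trans (M-≤ R S b≤b′) (cong₂ _∸_ (m≤n⇒m⊓n≡m a≤a′) (≤-antisym b′≤b b≤b′))
... | no b≰b′  = trans (M-> R S (≰⇒> b≰b′)) (cong (_∸ b R) (m≤n⇒m⊓n≡m (m≤n⇒m≤1+n a≤a′)))

M-⊒ : ∀ R S → S ⊑ R → M R S ≡ ∣ S ∣ʳ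
M-⊒ R S (nested b≤b′ a′≤a) = trans (M-≤ R S b≤b′) (cong (_∸ b S) (m≥n⇒m⊓n≡n a′≤a))

r+1≡a : ∀ R → r R ℤ.+ ℤ.1ℤ ≡ ℤ.+ a R
r+1≡a R = begin
  (ℤ.+ a R ℤ.- ℤ.1ℤ) ℤ.+ ℤ.1ℤ    ≡⟨ ℤ.+-assoc (ℤ.+ a R) (ℤ.- ℤ.1ℤ) ℤ.1ℤ ⟩
  ℤ.+ a R ℤ.+ (ℤ.- ℤ.1ℤ ℤ.+ ℤ.1ℤ) ≡⟨ cong (λ z → ℤ.+ a R ℤ.+ z) (ℤ.+-inverseˡ ℤ.1ℤ) ⟩
  ℤ.+ a R ℤ.+ ℤ.0ℤ                ≡⟨ ℤ.+-identityʳ (ℤ.+ a R) ⟩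
  ℤ.+ a R                         ∎
  where open ≡-Reasoning

∸-telescope : x ≤ y → y ≤ w → (y ∸ x) + (w ∸ y) ≡ w ∸ x
∸-telescope {x} {y} {w} x≤y y≤w = begin
  (y ∸ x) + (w ∸ y) ≡⟨ +-∸-comm (w ∸ y) x≤y ⟨
  y + (w ∸ y) ∸ x   ≡⟨ cong (_∸ x) (m+[n∸m]≡n y≤w) ⟩
  w ∸ x             ∎
  where open ≡-Reasoning

suc-∸ : y ≤ x → suc x ∸ y ≡ x ∸ y + 1
suc-∸ {y} {x} y≤x = trans (+-∸-assoc 1 y≤x) (+-comm 1 (x ∸ y))

+-chain : ∀ x y {z u v} → x + y ≡ z → z + u ≡ v → x + (y + u) ≡ v
+-chain x y {u = u} x+y≡z z+u≡v = trans (sym (+-assoc x y u)) (trans (cong (_+ u) x+y≡z) z+u≡v)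

induct-up : ∀ (P : ℕ → Set) {s t} → s ≤ t → P s → (∀ y → s ≤ y → y < t → P y → P (suc y)) → P t
induct-up P {t = zero} s≤0 ps step = subst P (n≤0⇒n≡0 s≤0) ps
induct-up P {s} {suc t} s≤1+t ps step with m≤n⇒m<n∨m≡n s≤1+t
... | inj₂ refl = ps
... | inj₁ s<1+t = step t s≤t (n<1+n t) (induct-up P s≤t ps λ y s≤y y<t → step y s≤y (m<n⇒m<1+n y<t))
  where
  s≤t : s ≤ t
  s≤t = m<1+n⇒m≤n s<1+t

induct-down : ∀ (P : ℕ → Set) {s t} → s ≤ t → P t → (∀ y → s ≤ y → y < t → P (suc y) → P y) → P s
induct-down P {t = zero} s≤0 pt step = subst P (sym (n≤0⇒n≡0 s≤0)) pt
induct-down P {s} {suc t} s≤1+t pt step with m≤n⇒m<n∨m≡n s≤1+t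
... | inj₂ refl = pt
... | inj₁ s<1+t = induct-down P s≤t (step t s≤t (n<1+n t) pt) λ y s≤y y<t → step y s≤y (m<n⇒m<1+n y<t)
  where
  s≤t : s ≤ t
  s≤t = m<1+n⇒m≤n s<1+t

threshold : ∀ (f : ℕ → ℕ) c n → f 0 ≤ c → c < f n → ∃ λ y → y < n × f y ≤ c × c < f (suc y)
threshold f c zero f0≤c c<f0 = ⊥-elim (<⇒≱ c<f0 f0≤c)
threshold f c (suc n) f0≤c c<f[1+n] with f n ≤? c
... | yes fn≤c = n , n<1+n n , fn≤c , c<f[1+n]
... | no fn≰c with threshold f c n f0≤c (≰⇒> fn≰c)
...   | y , y<n , below = y , m<n⇒m<1+n y<n , below

module _ {P : ℕ → Set} (P? : Decidable P) where

  private
    least-from : ∀ lo k → P (lo + k) →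
      ∃ λ w → lo ≤ w × w ≤ lo + k × P w × (∀ y → lo ≤ y → y < w → ¬ P y)
    least-from lo k p with P? lo
    ... | yes p-lo = lo , ≤-refl , m≤m+n lo k , p-lo , λ y lo≤y y<lo _ → <⇒≱ y<lo lo≤y
    least-from lo zero p | no ¬p-lo = ⊥-elim (¬p-lo (subst P (+-identityʳ lo) p))
    least-from lo (suc k) p | no ¬p-lo with least-from (suc lo) k (subst P (+-suc lo k) p)
    ... | w , lo<w , w≤ , pw , none = w , <⇒≤ lo<w , ≤-trans w≤ (≤-reflexive (sym (+-suc lo k))) , pw , none′
      where
      none′ : ∀ y → lo ≤ y → y < w → ¬ P y
      none′ y lo≤y y<w with lo ≟ y
      ... | yes refl = ¬p-lo
      ... | no lo≢y = none y (≤∧≢⇒< lo≤y lo≢y) y<w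

  least-in : ∀ {lo hi} → lo ≤ hi → P hi →
    ∃ λ w → lo ≤ w × w ≤ hi × P w × (∀ y → lo ≤ y → y < w → ¬ P y)
  least-in {lo} {hi} lo≤hi p with least-from lo (hi ∸ lo) (subst P (sym (m+[n∸m]≡n lo≤hi)) p)
  ... | w , lo≤w , w≤ , rest = w , lo≤w , ≤-trans w≤ (≤-reflexive (m+[n∸m]≡n lo≤hi)) , rest

  greatest-in : ∀ {lo hi} → lo ≤ hi → P lo →
    ∃ λ w → lo ≤ w × w ≤ hi × P w × (∀ y → w < y → y ≤ hi → ¬ P y)
  greatest-in {hi = zero} lo≤0 p = _ , ≤-refl , lo≤0 , p , λ y w<y y≤0 _ → <⇒≱ w<y (≤-trans y≤0 z≤n)
  greatest-in {hi = suc h} lo≤hi p with P? (suc h)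
  ... | yes p-hi = suc h , lo≤hi , ≤-refl , p-hi , λ y hi<y y≤hi _ → <⇒≱ hi<y y≤hi
  ... | no ¬p-hi with m≤n⇒m<n∨m≡n lo≤hi
  ...   | inj₂ refl = ⊥-elim (¬p-hi p)
  ...   | inj₁ lo<hi with greatest-in (m<1+n⇒m≤n lo<hi) p
  ...     | w , lo≤w , w≤h , pw , none = w , lo≤w , m≤n⇒m≤1+n w≤h , pw , none′
    where
    none′ : ∀ y → w < y → y ≤ suc h → ¬ P y
    none′ y w<y y≤hi with m≤n⇒m<n∨m≡n y≤hi
    ... | inj₂ refl = ¬p-hi
    ... | inj₁ y<hi = none y w<y (m<1+n⇒m≤n y<hi)

-- Lists, and segments [lo, lo + len) of ℕ

segment : ℕ → ℕ → List ℕ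
segment lo zero      = []
segment lo (suc len) = lo ∷ segment (suc lo) len

private
  shift : ∀ {j} lo len → j < suc lo + len → j < lo + suc len
  shift {j} lo len = subst (j <_) (sym (+-suc lo len))

All-segment : ∀ {P : ℕ → Set} lo len → (∀ j → lo ≤ j → j < lo + len → P j) → All P (segment lo len)
All-segment lo zero      f = []
All-segment lo (suc len) f =
  f lo ≤-refl (shift lo len (s≤s (m≤m+n lo len))) ∷
  All-segment (suc lo) len (λ j lo<j j< → f j (<⇒≤ lo<j) (shift lo len j<))

AllPairs-segment : ∀ {Q : ℕ → ℕ → Set} lo len → (∀ i j → lo ≤ i → i < j → j < lo + len → Q i j) →
                   AllPairs Q (segment lo len)
AllPairs-segment lo zero      f = []
AllPairs-segment lo (suc len) f =
  All-segment (suc lo) len (λ j lo<j j< → f lo j ≤-refl lo<j (shift lo len j<)) ∷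
  AllPairs-segment (suc lo) len (λ i j lo<i i<j j< → f i j (<⇒≤ lo<i) i<j (shift lo len j<))

Linked-segment : ∀ {Q : ℕ → ℕ → Set} lo len → (∀ t → lo ≤ t → suc t < lo + len → Q t (suc t)) →
                 Linked Q (segment lo len)
Linked-segment lo zero            f = []
Linked-segment lo (suc zero)      f = [-]
Linked-segment lo (suc (suc len)) f =
  f lo ≤-refl (shift lo (suc len) (m<m+n (suc lo) z<s)) ∷
  Linked-segment (suc lo) (suc len) (λ t lo<t t< → f t (<⇒≤ lo<t) (shift lo (suc len) t<))

segment-++ : ∀ lo x y → segment lo (x + y) ≡ segment lo x ++ segment (lo + x) y
segment-++ lo zero    y = cong (λ lo′ → segment lo′ y) (sym (+-identityʳ lo))
segment-++ lo (suc x) y = cong (lo ∷_) (trans (segment-++ (suc lo) x y)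
  (cong (λ lo′ → segment (suc lo) x ++ segment lo′ y) (sym (+-suc lo x))))

segment-snoc : ∀ lo n → segment lo (suc n) ≡ segment lo n ++ [ lo + n ]
segment-snoc lo n = subst (λ k → segment lo k ≡ segment lo n ++ [ lo + n ]) (+-comm n 1) (segment-++ lo n 1)

length-segment : ∀ lo n → length (segment lo n) ≡ n
length-segment lo zero    = refl
length-segment lo (suc n) = cong suc (length-segment (suc lo) n)

last-segment : ∀ lo n → last (segment lo (suc n)) ≡ just (lo + n)
last-segment lo zero    = cong just (sym (+-identityʳ lo))
last-segment lo (suc n) = trans (last-segment (suc lo) n) (cong just (sym (+-suc lo n)))

telescope : ∀ (c g : ℕ → ℕ) lo len → (∀ j → lo ≤ j → j < lo + len → c j + g j ≡ c (suc j)) →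
            c lo + sum (map g (segment lo len)) ≡ c (lo + len)
telescope c g lo zero      steps = trans (+-identityʳ (c lo)) (cong c (sym (+-identityʳ lo)))
telescope c g lo (suc len) steps = trans
  (+-chain (c lo) (g lo) (steps lo ≤-refl (shift lo len (s≤s (m≤m+n lo len))))
           (telescope c g (suc lo) len λ j lo<j j< → steps j (<⇒≤ lo<j) (shift lo len j<)))
  (cong c (sym (+-suc lo len)))

sum-segment-snoc : ∀ (g : ℕ → ℕ) lo n → sum (map g (segment lo (suc n))) ≡ sum (map g (segment lo n)) + g (lo + n)
sum-segment-snoc g lo n = begin
  sum (map g (segment lo (suc n)))              ≡⟨ cong (λ js → sum (map g js)) (segment-snoc lo n) ⟩
  sum (map g (segment lo n ++ [ lo + n ]))      ≡⟨ cong sum (map-++ g (segment lo n) [ lo + n ]) ⟩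
  sum (map g (segment lo n) ++ [ g (lo + n) ])  ≡⟨ sum-++ (map g (segment lo n)) [ g (lo + n) ] ⟩
  sum (map g (segment lo n)) + (g (lo + n) + 0) ≡⟨ cong (sum (map g (segment lo n)) +_) (+-identityʳ (g (lo + n))) ⟩
  sum (map g (segment lo n)) + g (lo + n)       ∎
  where open ≡-Reasoning

Linked-segment⁻ : ∀ {Q : ℕ → ℕ → Set} lo len → Linked Q (segment lo len) →
                  ∀ t → lo ≤ t → suc t < lo + len → Q t (suc t)
Linked-segment⁻ lo zero       _ t lo≤t t+1< = ⊥-elim (<⇒≱ t+1< (≤-trans (≤-reflexive (+-identityʳ lo)) (m≤n⇒m≤1+n lo≤t)))
Linked-segment⁻ lo (suc zero) _ t lo≤t t+1< = ⊥-elim (<⇒≱ t+1< (≤-trans (≤-reflexive (+-comm lo 1)) (s≤s lo≤t)))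
Linked-segment⁻ lo (suc (suc len)) (q ∷ qs) t lo≤t t+1< with lo ≟ t
... | yes refl = q
... | no lo≢t  =
  Linked-segment⁻ (suc lo) (suc len) qs t (≤∧≢⇒< lo≤t lo≢t) (subst (suc t <_) (+-suc lo (suc len)) t+1<)

tabulate-segment : ∀ {A : Set} (f : ℕ → A) n lo → tabulate {n = n} (λ i → f (lo + toℕ i)) ≡ map f (segment lo n)
tabulate-segment f zero    lo = refl
tabulate-segment f (suc n) lo = cong₂ _∷_ (cong f (+-identityʳ lo))
  (trans (tabulate-cong (λ i → cong f (+-suc lo (toℕ i)))) (tabulate-segment f n (suc lo)))

last-++ : ∀ {A : Set} (xs : List A) y ys → last (xs ++ y ∷ ys) ≡ last (y ∷ ys)
last-++ []           y ys = refl
last-++ (x ∷ [])     y ys = refl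
last-++ (x ∷ x′ ∷ xs) y ys = last-++ (x′ ∷ xs) y ys

last-map : ∀ {A B : Set} (f : A → B) xs → last (map f xs) ≡ Maybe.map f (last xs)
last-map f []           = refl
last-map f (x ∷ [])     = refl
last-map f (x ∷ x′ ∷ xs) = last-map f (x′ ∷ xs)

filter-middle : ∀ {A : Set} {P : A → Set} (P? : Decidable P) {xs ys zs : List A} →
                All (λ x → ¬ P x) xs → All P ys → All (λ x → ¬ P x) zs → filter P? (xs ++ ys ++ zs) ≡ ys
filter-middle P? {xs} {ys} {zs} none-xs all-ys none-zs = begin
  filter P? (xs ++ ys ++ zs)           ≡⟨ filter-++ P? xs (ys ++ zs) ⟩
  filter P? xs ++ filter P? (ys ++ zs) ≡⟨ cong₂ _++_ (filter-none P? none-xs) (filter-++ P? ys zs) ⟩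
  filter P? ys ++ filter P? zs         ≡⟨ cong₂ _++_ (filter-all P? all-ys) (filter-none P? none-zs) ⟩
  ys ++ []                             ≡⟨ ++-identityʳ ys ⟩
  ys                                   ∎
  where open ≡-Reasoning

-- The path as a cycle of rows indexed by ℕ

Mᴺ : (ℕ → Row) → ℕ → ℕ → ℕ
Mᴺ R i j = if does (i ≤? j) then M (R i) (R j) else M (R j) (R i)

Mᴺ-≤ : ∀ R i j → i ≤ j → Mᴺ R i j ≡ M (R i) (R j)
Mᴺ-≤ R i j i≤j = cong (λ c → if c then M (R i) (R j) else M (R j) (R i)) (dec-true (i ≤? j) i≤j)

Mᴺ-> : ∀ R i j → j < i → Mᴺ R i j ≡ M (R j) (R i)
Mᴺ-> R i j j<i = cong (λ c → if c then M (R i) (R j) else M (R j) (R i)) (dec-false (i ≤? j) (<⇒≱ j<i))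

-- The hypotheses of the proposition for rows indexed by ℕ: chord-commute is what minimality
-- provides, and the two ascent fields say that no ascending edge is strict.
record NonStrictCycle (m : ℕ) (R : ℕ → Row) : Set where
  field
    edge-¬commute   : ∀ t → t < m → ¬ Commute (R t) (R (suc t))
    chord-commute   : ∀ i j → 2 + i ≤ j → j ≤ m → ¬ (i ≡ 0 × j ≡ m) → Commute (R i) (R j)
    l₀<lₘ           : l (R 0) < l (R m)
    ¬commute₀ₘ      : ¬ Commute (R 0) (R m)
    ascent-adjacent : ∀ t → t < m → l (R t) < l (R (suc t)) → a (R t) ≡ b (R (suc t))
    ascent-¬covers  : ∀ t k → t < m → l (R t) < l (R (suc t)) → k ≤ m → k ≢ t → k ≢ suc t →
                      ¬ (∣ R k ∣ʳ + 1 ≤ Mᴺ R t k + Mᴺ R (suc t) k)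

module NonStrictCycleProperties {m′ : ℕ} {R : ℕ → Row} (C : NonStrictCycle (suc m′) R) where

  open NonStrictCycle C

  m : ℕ
  m = suc m′

  b[_] a[_] : ℕ → ℕ
  b[ i ] = b (R i)
  a[ i ] = a (R i)

  M[_,_] : ℕ → ℕ → ℕ
  M[ i , j ] = Mᴺ R i j

  Ascent : ℕ → Set
  Ascent t = b[ t ] < b[ suc t ]

  ascent? : ∀ t → Dec (Ascent t)
  ascent? t = b[ t ] <? b[ suc t ]

  AscentsOn DescentsOn : ℕ → ℕ → Set
  AscentsOn  s t = ∀ y → s ≤ y → y < t → Ascent y
  DescentsOn s t = ∀ y → s ≤ y → y < t → ¬ Ascent y

  AscentsExcept : ℕ → Set
  AscentsExcept d = ∀ y → y < m → y ≢ d → Ascent y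

  ascent-crosses : ∀ t → t < m → Ascent t → Crosses (R t) (R (suc t))
  ascent-crosses t t<m asc = ¬commute⇒crosses asc (edge-¬commute t t<m)

  descent-crosses : ∀ t → t < m → ¬ Ascent t → Crosses (R (suc t)) (R t)
  descent-crosses t t<m ¬asc with ¬commute⇒crosses⊎crosses (edge-¬commute t t<m)
  ... | inj₁ up   = ⊥-elim (¬asc (b<b′ up))
  ... | inj₂ down = down

  closing-crosses : Crosses (R 0) (R m)
  closing-crosses = ¬commute⇒crosses l₀<lₘ ¬commute₀ₘ

  chord-¬crosses : ∀ i j → 2 + i ≤ j → j ≤ m → ¬ (i ≡ 0 × j ≡ m) → ¬ Crosses (R i) (R j)
  chord-¬crosses i j i+2≤j j≤m ¬closing x = crosses⇒¬commute x (chord-commute i j i+2≤j j≤m ¬closing)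

  -- For the closing pair this holds because R 0 crosses R m the other way.
  ¬crosses-backward : ∀ i j → 2 + i ≤ j → j ≤ m → ¬ Crosses (R j) (R i)
  ¬crosses-backward i j i+2≤j j≤m x with i ≟ 0 | j ≟ m
  ... | yes refl | yes refl = <-asym l₀<lₘ (b<b′ x)
  ... | no i≢0   | _        = crosses⇒¬commute x (sym (chord-commute i j i+2≤j j≤m (λ (i≡0 , _) → i≢0 i≡0)))
  ... | _        | no j≢m   = crosses⇒¬commute x (sym (chord-commute i j i+2≤j j≤m (λ (_ , j≡m) → j≢m j≡m)))

  row-nonempty : ∀ t → t ≤ m → b[ t ] < a[ t ]
  row-nonempty t t≤m with m≤n⇒m<n∨m≡n t≤m
  ... | inj₂ refl = ≤-<-trans (b′≤a closing-crosses) (a<a′ closing-crosses)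
  ... | inj₁ t<m with ascent? t
  ...   | yes asc = <-≤-trans asc (b′≤a (ascent-crosses t t<m asc))
  ...   | no ¬asc = let x = descent-crosses t t<m ¬asc in ≤-<-trans (b′≤a x) (a<a′ x)

  -- Otherwise R t and R (1 + t) would cover R (2 + t) together with one cell to spare.
  ascent-descent : ∀ t → 2 + t ≤ m → Ascent t → ¬ Ascent (suc t) → b[ 2 + t ] < b[ t ] × R t ⊑ R (2 + t)
  ascent-descent t t+2≤m asc ¬asc = b[u]<b[t] , nested (<⇒≤ b[u]<b[t]) a[t]≤a[u]
    where
    s u : ℕ
    s = suc t
    u = suc s
    t<m : t < m
    t<m = <-trans (n<1+n t) t+2≤m
    down : Crosses (R u) (R s)
    down = descent-crosses s t+2≤m ¬asc
    a[t]≡b[s] : a[ t ] ≡ b[ s ]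
    a[t]≡b[s] = ascent-adjacent t t<m asc
    a[t]≤a[u] : a[ t ] ≤ a[ u ]
    a[t]≤a[u] = subst (_≤ a[ u ]) (sym a[t]≡b[s]) (b′≤a down)
    b[u]<b[t] : b[ u ] < b[ t ]
    b[u]<b[t] with b[ u ] <? b[ t ]
    ... | yes lt = lt
    ... | no b[u]≮b[t] = ⊥-elim (ascent-¬covers t u t<m asc t+2≤m
                           (λ u≡t → <-irrefl (sym u≡t) (<-trans (n<1+n t) (n<1+n s))) (λ u≡s → <-irrefl (sym u≡s) (n<1+n s))
                           (≤-reflexive (sym covered)))
      where
      b[u]≤a[t] : b[ u ] ≤ a[ t ]
      b[u]≤a[t] = subst (b[ u ] ≤_) (sym a[t]≡b[s]) (<⇒≤ (b<b′ down))
      covered : M[ t , u ] + M[ s , u ] ≡ ∣ R u ∣ʳ + 1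
      covered = begin
        M[ t , u ] + M[ s , u ]
          ≡⟨ cong₂ _+_ (Mᴺ-≤ R t u (m≤n⇒m≤1+n (n≤1+n t))) (Mᴺ-≤ R s u (n≤1+n s)) ⟩
        M (R t) (R u) + M (R s) (R u)             ≡⟨ cong₂ _+_ (M-≤-≤ (R t) (R u) (≮⇒≥ b[u]≮b[t]) a[t]≤a[u])
                                                               (M->-> (R s) (R u) (b<b′ down) (a<a′ down)) ⟩
        (a[ t ] ∸ b[ u ]) + (suc a[ u ] ∸ b[ s ]) ≡⟨ cong (λ x → (a[ t ] ∸ b[ u ]) + (suc a[ u ] ∸ x)) a[t]≡b[s] ⟨
        (a[ t ] ∸ b[ u ]) + (suc a[ u ] ∸ a[ t ]) ≡⟨ ∸-telescope b[u]≤a[t] (m≤n⇒m≤1+n a[t]≤a[u]) ⟩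
        suc a[ u ] ∸ b[ u ]                       ≡⟨ suc-∸ (≤-trans b[u]≤a[t] a[t]≤a[u]) ⟩
        ∣ R u ∣ʳ + 1                              ∎
        where open ≡-Reasoning

  -- Otherwise R (1 + t) and R (2 + t) would cover R t together with one cell to spare.
  descent-ascent : ∀ t → 2 + t ≤ m → ¬ Ascent t → Ascent (suc t) → R (2 + t) ⊑ R t × a[ 2 + t ] < a[ t ]
  descent-ascent t t+2≤m ¬asc asc = nested b[t]≤b[u] (<⇒≤ a[u]<a[t]) , a[u]<a[t]
    where
    s u : ℕ
    s = suc t
    u = suc s
    down : Crosses (R s) (R t)
    down = descent-crosses t (<-trans (n<1+n t) t+2≤m) ¬asc
    a[s]≡b[u] : a[ s ] ≡ b[ u ]
    a[s]≡b[u] = ascent-adjacent s t+2≤m asc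
    b[t]≤b[u] : b[ t ] ≤ b[ u ]
    b[t]≤b[u] = subst (b[ t ] ≤_) a[s]≡b[u] (b′≤a down)
    a[u]<a[t] : a[ u ] < a[ t ]
    a[u]<a[t] with a[ u ] <? a[ t ]
    ... | yes lt = lt
    ... | no a[u]≮a[t] = ⊥-elim (ascent-¬covers s t t+2≤m asc (<⇒≤ (<-trans (n<1+n t) t+2≤m))
                           (λ t≡s → <-irrefl t≡s (n<1+n t)) (λ t≡u → <-irrefl t≡u (<-trans (n<1+n t) (n<1+n s)))
                           (≤-reflexive (sym covered)))
      where
      covered : M[ s , t ] + M[ u , t ] ≡ ∣ R t ∣ʳ + 1
      covered = begin
        M[ s , t ] + M[ u , t ]
          ≡⟨ cong₂ _+_ (Mᴺ-> R s t (n<1+n t)) (Mᴺ-> R u t (<-trans (n<1+n t) (n<1+n s))) ⟩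
        M (R t) (R s) + M (R t) (R u)             ≡⟨ cong₂ _+_ (M->-> (R t) (R s) (b<b′ down) (a<a′ down))
                                                               (M-≤-≤ (R t) (R u) b[t]≤b[u] (≮⇒≥ a[u]≮a[t])) ⟩
        (suc a[ s ] ∸ b[ t ]) + (a[ t ] ∸ b[ u ]) ≡⟨ cong (λ x → (suc a[ s ] ∸ b[ t ]) + (a[ t ] ∸ x)) a[s]≡b[u] ⟨
        (suc a[ s ] ∸ b[ t ]) + (suc a[ t ] ∸ suc a[ s ])
          ≡⟨ ∸-telescope (m≤n⇒m≤1+n (b′≤a down)) (s≤s (<⇒≤ (a<a′ down))) ⟩
        suc a[ t ] ∸ b[ t ]                       ≡⟨ suc-∸ (≤-trans (b′≤a down) (<⇒≤ (a<a′ down))) ⟩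
        ∣ R t ∣ʳ + 1                              ∎
        where open ≡-Reasoning

  ascents⇒a≤ : ∀ s t → s ≤ t → t ≤ m → AscentsOn s t → a[ s ] ≤ a[ t ]
  ascents⇒a≤ s t s≤t t≤m ascs = induct-up (λ y → a[ s ] ≤ a[ y ]) s≤t ≤-refl λ y s≤y y<t a[s]≤a[y] →
    ≤-trans a[s]≤a[y] (<⇒≤ (a<a′ (ascent-crosses y (<-≤-trans y<t t≤m) (ascs y s≤y y<t))))

  ascents⇒a< : ∀ s t → s < t → t ≤ m → AscentsOn s t → a[ s ] < a[ t ]
  ascents⇒a< s t s<t t≤m ascs =
    <-≤-trans (a<a′ (ascent-crosses s (<-≤-trans s<t t≤m) (ascs s ≤-refl s<t)))
              (ascents⇒a≤ (suc s) t s<t t≤m λ y s<y y<t → ascs y (<⇒≤ s<y) y<t)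

  ascents⇒a≤b : ∀ s t → s < t → t ≤ m → AscentsOn s t → a[ s ] ≤ b[ t ]
  ascents⇒a≤b s (suc t) s<1+t 1+t≤m ascs =
    subst (a[ s ] ≤_) (ascent-adjacent t 1+t≤m (ascs t (m<1+n⇒m≤n s<1+t) (n<1+n t)))
          (ascents⇒a≤ s t (m<1+n⇒m≤n s<1+t) (<⇒≤ 1+t≤m) λ y s≤y y<t → ascs y s≤y (m<n⇒m<1+n y<t))

  descents⇒b≤ : ∀ s t → s ≤ t → t ≤ m → DescentsOn s t → b[ t ] ≤ b[ s ]
  descents⇒b≤ s t s≤t t≤m descs = induct-up (λ y → b[ y ] ≤ b[ s ]) s≤t ≤-refl λ y s≤y y<t b[y]≤b[s] →
    ≤-trans (<⇒≤ (b<b′ (descent-crosses y (<-≤-trans y<t t≤m) (descs y s≤y y<t)))) b[y]≤b[s]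

  descents⇒b< : ∀ s t → s < t → t ≤ m → DescentsOn s t → b[ t ] < b[ s ]
  descents⇒b< s t s<t t≤m descs =
    ≤-<-trans (descents⇒b≤ (suc s) t s<t t≤m λ y s<y y<t → descs y (<⇒≤ s<y) y<t)
              (b<b′ (descent-crosses s (<-≤-trans s<t t≤m) (descs s ≤-refl s<t)))

  ⊑-leftwards : ∀ k s t → s ≤ t → t ≤ m → AscentsOn s t →
                (∀ y → s ≤ y → y < t → ¬ Crosses (R y) (R k)) → R t ⊑ R k → R s ⊑ R k
  ⊑-leftwards k s t s≤t t≤m ascs ¬crosses R[t]⊑R[k] = induct-down (λ y → R y ⊑ R k) s≤t R[t]⊑R[k] step
    where
    step : ∀ y → s ≤ y → y < t → R (suc y) ⊑ R k → R y ⊑ R k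
    step y s≤y y<t (nested b[k]≤b[y+1] a[y+1]≤a[k]) = nested b[k]≤b[y] a[y]≤a[k]
      where
      asc : Ascent y
      asc = ascs y s≤y y<t
      up : Crosses (R y) (R (suc y))
      up = ascent-crosses y (<-≤-trans y<t t≤m) asc
      a[y]≤a[k] : a[ y ] ≤ a[ k ]
      a[y]≤a[k] = ≤-trans (<⇒≤ (a<a′ up)) a[y+1]≤a[k]
      b[k]≤b[y] : b[ k ] ≤ b[ y ]
      b[k]≤b[y] with b[ y ] <? b[ k ]
      ... | no b[y]≮b[k] = ≮⇒≥ b[y]≮b[k]
      ... | yes b[y]<b[k] = ⊥-elim (¬crosses y s≤y y<t (crossing b[y]<b[k]
              (subst (b[ k ] ≤_) (sym (ascent-adjacent y (<-≤-trans y<t t≤m) asc)) b[k]≤b[y+1])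
              (<-≤-trans (a<a′ up) a[y+1]≤a[k])))

  ⊑-rightwards : ∀ k s t → s ≤ t → t ≤ m → AscentsOn s t →
                 (∀ y → s < y → y ≤ t → ¬ Crosses (R k) (R y)) → R s ⊑ R k → R t ⊑ R k
  ⊑-rightwards k s t s≤t t≤m ascs ¬crosses R[s]⊑R[k] = induct-up (λ y → R y ⊑ R k) s≤t R[s]⊑R[k] step
    where
    step : ∀ y → s ≤ y → y < t → R y ⊑ R k → R (suc y) ⊑ R k
    step y s≤y y<t (nested b[k]≤b[y] a[y]≤a[k]) = nested (≤-trans b[k]≤b[y] (<⇒≤ asc)) a[y+1]≤a[k]
      where
      asc : Ascent y
      asc = ascs y s≤y y<t
      a[y+1]≤a[k] : a[ suc y ] ≤ a[ k ]
      a[y+1]≤a[k] with a[ k ] <? a[ suc y ]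
      ... | no a[k]≮a[y+1] = ≮⇒≥ a[k]≮a[y+1]
      ... | yes a[k]<a[y+1] = ⊥-elim (¬crosses (suc y) (s≤s s≤y) y<t (crossing (≤-<-trans b[k]≤b[y] asc)
              (subst (_≤ a[ k ]) (ascent-adjacent y (<-≤-trans y<t t≤m) asc) a[y]≤a[k])
              a[k]<a[y+1]))

  -- Two descents with only ascents between them are adjacent: otherwise the ascending run
  -- between them nests into both neighbours, and the two outer rows would cross.
  consecutive-descents : ∀ u v → u < v → v < m → ¬ Ascent u → ¬ Ascent v → AscentsOn (suc u) v → v ≡ suc u
  consecutive-descents u (suc v) u<1+v 1+v<m ¬asc-u ¬asc-1+v ascs with m≤n⇒m<n∨m≡n (m<1+n⇒m≤n u<1+v)
  ... | inj₂ refl = refl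
  ... | inj₁ u<v = ⊥-elim (¬crosses-backward u (2 + v) (s≤s (s≤s (<⇒≤ u<v))) 1+v<m
                      (crossing (≤-<-trans (b′≤b R[u+1]⊑R[v+2]) (b<b′ down-u))
                                (≤-trans (b′≤b R[v+1]⊑R[u]) (b′≤a down-v))
                                (<-≤-trans (a<a′ down-v) (a≤a′ R[v+1]⊑R[u]))))
    where
    v<m : v < m
    v<m = <-trans (n<1+n v) 1+v<m
    down-u : Crosses (R (suc u)) (R u)
    down-u = descent-crosses u (<-trans u<v v<m) ¬asc-u
    down-v : Crosses (R (2 + v)) (R (suc v))
    down-v = descent-crosses (suc v) 1+v<m ¬asc-1+v
    R[u+1]⊑R[v+2] : R (suc u) ⊑ R (2 + v)
    R[u+1]⊑R[v+2] = ⊑-leftwards (2 + v) (suc u) v u<v (<⇒≤ v<m)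
      (λ y u<y y<v → ascs y u<y (m<n⇒m<1+n y<v))
      (λ y u<y y<v → chord-¬crosses y (2 + v) (s≤s (s≤s (<⇒≤ y<v))) 1+v<m
                       (λ (y≡0 , _) → <⇒≢ (≤-trans (s≤s z≤n) u<y) (sym y≡0)))
      (proj₂ (ascent-descent v 1+v<m (ascs v u<v (n<1+n v)) ¬asc-1+v))
    R[v+1]⊑R[u] : R (suc v) ⊑ R u
    R[v+1]⊑R[u] = ⊑-rightwards u (2 + u) (suc v) (s≤s u<v) (<⇒≤ 1+v<m)
      (λ y u+2≤y y<1+v → ascs y (<⇒≤ u+2≤y) y<1+v)
      (λ y u+2<y y≤1+v → chord-¬crosses u y (<⇒≤ u+2<y) (≤-trans y≤1+v (<⇒≤ 1+v<m))
                           (λ (_ , y≡m) → <⇒≢ (≤-<-trans y≤1+v 1+v<m) y≡m))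
      (proj₁ (descent-ascent u (≤-trans (s≤s u<v) (<⇒≤ 1+v<m)) ¬asc-u (ascs (suc u) ≤-refl (s≤s u<v))))

  descents-contiguous : ∀ d e → d ≤ e → e < m → ¬ Ascent d → ¬ Ascent e → DescentsOn d (suc e)
  descents-contiguous d e d≤e e<m ¬asc-d ¬asc-e y d≤y y≤e asc-y
    with greatest-in (λ z → ¬? (ascent? z)) d≤y ¬asc-d | least-in (λ z → ¬? (ascent? z)) (m<1+n⇒m≤n y≤e) ¬asc-e
  ... | u , _ , u≤y , ¬asc-u , none-above | w , y≤w , w≤e , ¬asc-w , none-below =
    <-irrefl (sym (consecutive-descents u w (<-≤-trans u<y y≤w) (≤-<-trans w≤e e<m) ¬asc-u ¬asc-w between)) (≤-<-trans u<y y<w)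
    where
    u<y : u < y
    u<y = ≤∧≢⇒< u≤y (λ u≡y → ¬asc-u (subst Ascent (sym u≡y) asc-y))
    y<w : y < w
    y<w = ≤∧≢⇒< y≤w (λ y≡w → ¬asc-w (subst Ascent y≡w asc-y))
    between : AscentsOn (suc u) w
    between z u<z z<w with z ≤? y
    ... | yes z≤y = decidable-stable (ascent? z) (none-above z u<z z≤y)
    ... | no z≰y  = decidable-stable (ascent? z) (none-below z (<⇒≤ (≰⇒> z≰y)) z<w)

  -- R 0 nests in the first row of the run, which then pushes b[ m ] below b[ 0 ].
  ¬final-descent-run : ∀ d → suc d < m → AscentsOn 0 d → DescentsOn d m → ⊥
  ¬final-descent-run zero 1<m _ descs = <-asym l₀<lₘ (descents⇒b< 0 m (<-trans z<s 1<m) ≤-refl descs)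
  ¬final-descent-run (suc d) d+2<m ascs descs = <-asym l₀<lₘ (<-≤-trans b[m]<b[d+2] (b′≤b R[0]⊑R[d+2]))
    where
    R[0]⊑R[d+2] : R 0 ⊑ R (2 + d)
    R[0]⊑R[d+2] = ⊑-leftwards (2 + d) 0 d z≤n (<⇒≤ (<-trans (<-trans (n<1+n d) (n<1+n (suc d))) d+2<m))
      (λ y _ y<d → ascs y z≤n (m<n⇒m<1+n y<d))
      (λ y _ y<d → chord-¬crosses y (2 + d) (s≤s (s≤s (<⇒≤ y<d))) (<⇒≤ d+2<m) (λ (_ , d+2≡m) → <⇒≢ d+2<m d+2≡m))
      (proj₂ (ascent-descent d (<⇒≤ d+2<m) (ascs d z≤n (n<1+n d)) (descs (suc d) ≤-refl (<-trans (n<1+n (suc d)) d+2<m))))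
    b[m]<b[d+2] : b[ m ] < b[ 2 + d ]
    b[m]<b[d+2] = descents⇒b< (2 + d) m d+2<m ≤-refl (λ y d+2≤y y<m → descs y (<⇒≤ d+2≤y) y<m)

  -- Where the a-ends of an ascending run pass a[ m ], R m would cross the run.
  passing-point : ∀ y → 3 + y ≤ m → Ascent y → a[ y ] ≤ a[ m ] → a[ m ] < a[ suc y ] → b[ suc y ] ≤ b[ m ]
  passing-point y y+3≤m asc a[y]≤a[m] a[m]<a[y+1] with b[ m ] <? b[ suc y ]
  ... | no b[m]≮b[y+1] = ≮⇒≥ b[m]≮b[y+1]
  ... | yes b[m]<b[y+1] = ⊥-elim (¬crosses-backward (suc y) m y+3≤m ≤-refl
          (crossing b[m]<b[y+1] (subst (_≤ a[ m ]) a[y]≡b[y+1] a[y]≤a[m]) a[m]<a[y+1]))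
    where
    a[y]≡b[y+1] : a[ y ] ≡ b[ suc y ]
    a[y]≡b[y+1] = ascent-adjacent y (<-≤-trans (m≤n+m (suc y) 2) y+3≤m) asc

  -- Past its first step the run from R 0 has a-ends beyond a[ 0 ] ≥ b[ m ]; at its first step
  -- b[ 1 ] = a[ 0 ] = b[ m ], and R m′ would cross R 1.
  ¬early-passing : ∀ y → 3 + y ≤ m′ → AscentsOn 0 (suc y) → Ascent m′ → ¬ (b[ suc y ] ≤ b[ m ])
  ¬early-passing (suc y) y+4≤m′ ascs _ b[y+2]≤b[m] =
    <⇒≱ (ascents⇒a< 0 (suc y) z<s (<⇒≤ y+1<m) λ z _ z<y+1 → ascs z z≤n (m<n⇒m<1+n z<y+1)) (begin
      a[ suc y ] ≡⟨ ascent-adjacent (suc y) y+1<m (ascs (suc y) z≤n ≤-refl) ⟩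
      b[ 2 + y ] ≤⟨ b[y+2]≤b[m] ⟩
      b[ m ]     ≤⟨ b′≤a closing-crosses ⟩
      a[ 0 ]     ∎)
    where
    open ≤-Reasoning
    y+1<m : suc y < m
    y+1<m = <-≤-trans (m≤n+m (2 + y) 2) (m≤n⇒m≤1+n y+4≤m′)
  ¬early-passing zero 3≤m′ ascs asc-m′ b[1]≤b[m] = ¬crosses-backward 1 m′ 3≤m′ (n≤1+n m′)
    (crossing (<-≤-trans asc-m′ (≤-trans (b′≤a closing-crosses) (≤-reflexive a[0]≡b[1])))
              (≤-trans b[1]≤b[m] (≤-reflexive (sym a[m′]≡b[m])))
              (≤-<-trans (≤-trans (≤-reflexive a[m′]≡b[m]) (b′≤a closing-crosses))
                         (a<a′ (ascent-crosses 0 0<m (ascs 0 z≤n z<s)))))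
    where
    0<m : 0 < m
    0<m = z<s
    a[0]≡b[1] : a[ 0 ] ≡ b[ 1 ]
    a[0]≡b[1] = ascent-adjacent 0 0<m (ascs 0 z≤n z<s)
    a[m′]≡b[m] : a[ m′ ] ≡ b[ m ]
    a[m′]≡b[m] = ascent-adjacent m′ (n<1+n m′) asc-m′

  b≤a[m] : ∀ d → 2 + d ≤ m′ → AscentsOn 0 d → Ascent m′ → b[ d ] ≤ a[ m ]
  b≤a[m] zero _ _ _ = <⇒≤ (<-trans (row-nonempty 0 z≤n) (a<a′ closing-crosses))
  b≤a[m] (suc d) d+3≤m′ ascs asc-m′ with b[ suc d ] ≤? a[ m ]
  ... | yes b≤a = b≤a
  ... | no b≰a with threshold a[_] a[ m ] d (<⇒≤ (a<a′ closing-crosses)) a[m]<a[d]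
    where
    a[m]<a[d] : a[ m ] < a[ d ]
    a[m]<a[d] = subst (a[ m ] <_) (sym (ascent-adjacent d (<-≤-trans (m≤n+m (suc d) 2) (m≤n⇒m≤1+n d+3≤m′))
                                                          (ascs d z≤n (n<1+n d))))
                      (≰⇒> b≰a)
  ...   | y , y<d , a[y]≤a[m] , a[m]<a[y+1] = ⊥-elim (¬early-passing y (≤-trans (s≤s (s≤s y<d)) (≤-trans (n≤1+n _) d+3≤m′))
            (λ z _ z<y+1 → ascs z z≤n (<-≤-trans z<y+1 (m≤n⇒m≤1+n y<d)))
            asc-m′
            (passing-point y (≤-trans (s≤s (s≤s y<d)) (≤-trans (n≤1+n _) (m≤n⇒m≤1+n d+3≤m′)))
                           (ascs y z≤n (m<n⇒m<1+n y<d)) a[y]≤a[m] a[m]<a[y+1]))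

  -- Otherwise R j would cross R e, as it starts where R (j ∸ 1) ends.
  left-of-descent-pair : ∀ e → 3 + e ≤ m → ¬ Ascent e → ¬ Ascent (suc e) → AscentsOn (2 + e) m →
                         a[ m ] < a[ e ] → ∀ j → 2 + e ≤ j → j ≤ m′ → a[ j ] < b[ e ]
  left-of-descent-pair e e+3≤m ¬asc-e ¬asc-e+1 ascs a[m]<a[e] j e+2≤j j≤m′ =
    induct-up (λ j → a[ j ] < b[ e ]) e+2≤j base step
    where
    base : a[ 2 + e ] < b[ e ]
    base with a[ 2 + e ] <? b[ e ]
    ... | yes lt = lt
    ... | no a≮b = ⊥-elim (¬crosses-backward e (2 + e) ≤-refl (<⇒≤ e+3≤m)
            (crossing (<-trans (b<b′ down-e+1) (b<b′ down-e)) (≮⇒≥ a≮b) (<-trans (a<a′ down-e+1) (a<a′ down-e))))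
      where
      down-e : Crosses (R (suc e)) (R e)
      down-e = descent-crosses e (<-≤-trans (m≤n+m (suc e) 2) e+3≤m) ¬asc-e
      down-e+1 : Crosses (R (2 + e)) (R (suc e))
      down-e+1 = descent-crosses (suc e) (≤-trans (n≤1+n (2 + e)) e+3≤m) ¬asc-e+1
    step : ∀ y → 2 + e ≤ y → y < j → a[ y ] < b[ e ] → a[ suc y ] < b[ e ]
    step y e+2≤y y<j a[y]<b[e] with a[ suc y ] <? b[ e ]
    ... | yes lt = lt
    ... | no a≮b = ⊥-elim (¬crosses-backward e (suc y) (m≤n⇒m≤1+n e+2≤y) y+1≤m
            (crossing (subst (_< b[ e ]) (ascent-adjacent y y<m (ascs y e+2≤y y<m)) a[y]<b[e]) (≮⇒≥ a≮b)
                      (≤-<-trans (ascents⇒a≤ (suc y) m y+1≤m ≤-refl λ z y<z z<m → ascs z (≤-trans e+2≤y (<⇒≤ y<z)) z<m)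
                                 a[m]<a[e])))
      where
      y+1≤m : suc y ≤ m
      y+1≤m = s≤s (≤-trans (<⇒≤ y<j) j≤m′)
      y<m : y < m
      y<m = y+1≤m

  -- R m nests in the last descending row of the run, hence lies left of the one before it,
  -- below the start of the run; this contradicts b≤a[m].
  ¬inner-descent-run : ∀ d e → d < e → 2 + e ≤ m → AscentsOn 0 d → DescentsOn d (suc e) → AscentsOn (suc e) m → ⊥
  ¬inner-descent-run d (suc e) (s≤s d≤e) e+3≤m ascs-before descs ascs-after =
    <⇒≱ (<-≤-trans a[m]<b[e] (descents⇒b≤ d e d≤e (<⇒≤ e<m) λ y d≤y y<e → descs y d≤y (m<n⇒m<1+n (m<n⇒m<1+n y<e))))
        (b≤a[m] d (≤-pred (≤-trans (s≤s (s≤s (s≤s d≤e))) e+3≤m)) ascs-before asc-m′)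
    where
    e<m : e < m
    e<m = <-≤-trans (m≤n+m (suc e) 2) e+3≤m
    ¬asc-e : ¬ Ascent e
    ¬asc-e = descs e d≤e (m<n⇒m<1+n (n<1+n e))
    ¬asc-e+1 : ¬ Ascent (suc e)
    ¬asc-e+1 = descs (suc e) (m≤n⇒m≤1+n d≤e) (n<1+n (suc e))
    asc-m′ : Ascent m′
    asc-m′ = ascs-after m′ (≤-pred e+3≤m) (n<1+n m′)
    R[m]⊑R[e+1] : R m ⊑ R (suc e)
    R[m]⊑R[e+1] = ⊑-rightwards (suc e) (3 + e) m e+3≤m ≤-refl
      (λ y e+3≤y y<m → ascs-after y (<⇒≤ e+3≤y) y<m)
      (λ y e+3<y y≤m → chord-¬crosses (suc e) y (<⇒≤ e+3<y) y≤m (λ (e+1≡0 , _) → 1+n≢0 e+1≡0))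
      (proj₁ (descent-ascent (suc e) e+3≤m ¬asc-e+1 (ascs-after (2 + e) ≤-refl e+3≤m)))
    a[m]<a[e] : a[ m ] < a[ e ]
    a[m]<a[e] = ≤-<-trans (a≤a′ R[m]⊑R[e+1]) (a<a′ (descent-crosses e e<m ¬asc-e))
    b[m]<b[e] : b[ m ] < b[ e ]
    b[m]<b[e] = subst (_< b[ e ]) (ascent-adjacent m′ (n<1+n m′) asc-m′)
      (left-of-descent-pair e e+3≤m ¬asc-e ¬asc-e+1 ascs-after a[m]<a[e] m′ (≤-pred e+3≤m) ≤-refl)
    a[m]<b[e] : a[ m ] < b[ e ]
    a[m]<b[e] with a[ m ] <? b[ e ]
    ... | yes lt = lt
    ... | no a≮b = ⊥-elim (¬crosses-backward e m (<⇒≤ e+3≤m) ≤-refl (crossing b[m]<b[e] (≮⇒≥ a≮b) a[m]<a[e]))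

  ¬all-ascents : 0 < m′ → ¬ AscentsOn 0 m
  ¬all-ascents 0<m′ ascs = <⇒≱ (ascents⇒a< 0 m′ 0<m′ (n≤1+n m′) λ y _ y<m′ → ascs y z≤n (m<n⇒m<1+n y<m′))
    (≤-trans (≤-reflexive (ascent-adjacent m′ (n<1+n m′) (ascs m′ z≤n (n<1+n m′)))) (b′≤a closing-crosses))

  ¬descent-run : ∀ d e → d < e → e < m → AscentsOn 0 d → DescentsOn d (suc e) → AscentsOn (suc e) m → ⊥
  ¬descent-run d e d<e e<m ascs-before descs ascs-after with m≤n⇒m<n∨m≡n e<m
  ... | inj₁ e+1<m = ¬inner-descent-run d e d<e e+1<m ascs-before descs ascs-after
  ... | inj₂ refl  = ¬final-descent-run d (≤-<-trans d<e e<m) ascs-before descs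

  first-descent : 0 < m′ → ∃ λ d → d < m × ¬ Ascent d × AscentsOn 0 d
  first-descent 0<m′ with least-in (λ w → m ≤? w ⊎-dec ¬? (ascent? w)) (z≤n {m}) (inj₁ ≤-refl)
  ... | d , _ , d≤m , m≤d⊎¬asc-d , none-below = first (m≤n⇒m<n∨m≡n d≤m) m≤d⊎¬asc-d
    where
    ascs-before : AscentsOn 0 d
    ascs-before y _ y<d = decidable-stable (ascent? y) (λ ¬asc → none-below y z≤n y<d (inj₂ ¬asc))
    first : d < m ⊎ d ≡ m → m ≤ d ⊎ ¬ Ascent d → ∃ λ d → d < m × ¬ Ascent d × AscentsOn 0 d
    first (inj₂ refl) _             = ⊥-elim (¬all-ascents 0<m′ ascs-before)
    first (inj₁ d<m)  (inj₁ m≤d)    = ⊥-elim (<⇒≱ d<m m≤d)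
    first (inj₁ d<m)  (inj₂ ¬asc-d) = d , d<m , ¬asc-d , ascs-before

  last-descent : ∀ d → d < m → ¬ Ascent d → ∃ λ e → d ≤ e × e < m × ¬ Ascent e × AscentsOn (suc e) m
  last-descent d d<m ¬asc-d with greatest-in (λ z → ¬? (ascent? z)) (m<1+n⇒m≤n d<m) ¬asc-d
  ... | e , d≤e , e≤m′ , ¬asc-e , none-after =
    e , d≤e , s≤s e≤m′ , ¬asc-e , λ y e<y y<m → decidable-stable (ascent? y) (none-after y e<y (m<1+n⇒m≤n y<m))

  unique-descent : 0 < m′ → ∃ λ d → d < m × ¬ Ascent d × AscentsExcept d
  unique-descent 0<m′ with first-descent 0<m′
  ... | d , d<m , ¬asc-d , ascs-before with last-descent d d<m ¬asc-d
  ...   | e , d≤e , e<m , ¬asc-e , ascs-after with m≤n⇒m<n∨m≡n d≤e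
  ...     | inj₁ d<e  =
    ⊥-elim (¬descent-run d e d<e e<m ascs-before (descents-contiguous d e d≤e e<m ¬asc-d ¬asc-e) ascs-after)
  ...     | inj₂ refl = d , d<m , ¬asc-d , others
    where
    others : AscentsExcept d
    others y y<m y≢d with <-cmp y d
    ... | tri< y<d _ _ = ascs-before y z≤n y<d
    ... | tri≈ _ y≡d _ = ⊥-elim (y≢d y≡d)
    ... | tri> _ _ d<y = ascs-after y d<y y<m

  -- With a single descent at d, a[ d ∸ 1 ] ≤ a[ 1 + d ] ≤ a[ m′ ] = b[ m ] ≤ a[ 0 ],
  -- so the ascending runs on either side of an inner descent have length one.
  inner-descent-position : ∀ d → 0 < d → d < m′ → ¬ Ascent d → AscentsExcept d → d ≡ 1 × m′ ≡ 2
  inner-descent-position (suc d) _ d+1<m′ ¬asc ascs = cong suc d≡0 , m′≡2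
    where
    d+1<m : suc d < m
    d+1<m = m<n⇒m<1+n d+1<m′
    d<m : d < m
    d<m = <-trans (n<1+n d) d+1<m
    ascs-below : AscentsOn 0 d
    ascs-below y _ y<d = ascs y (<-trans y<d d<m) λ y≡1+d → <-asym y<d (subst (d <_) (sym y≡1+d) (n<1+n d))
    ascs-above : AscentsOn (2 + d) m′
    ascs-above y d+2≤y y<m′ = ascs y (m<n⇒m<1+n y<m′) λ y≡1+d → <-irrefl (sym y≡1+d) d+2≤y
    a[d]≤a[d+2] : a[ d ] ≤ a[ 2 + d ]
    a[d]≤a[d+2] = a≤a′ (proj₂ (ascent-descent d d+1<m (ascs d d<m (λ d≡1+d → <-irrefl d≡1+d (n<1+n d))) ¬asc))
    a[d+2]≤a[m′] : a[ 2 + d ] ≤ a[ m′ ]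
    a[d+2]≤a[m′] = ascents⇒a≤ (2 + d) m′ d+1<m′ (n≤1+n m′) ascs-above
    a[m′]≤a[0] : a[ m′ ] ≤ a[ 0 ]
    a[m′]≤a[0] = ≤-trans (≤-reflexive (ascent-adjacent m′ (n<1+n m′) asc-m′)) (b′≤a closing-crosses)
      where
      asc-m′ : Ascent m′
      asc-m′ = ascs m′ (n<1+n m′) λ m′≡1+d → <-irrefl (sym m′≡1+d) d+1<m′
    d≡0 : d ≡ 0
    d≡0 with d ≟ 0
    ... | yes d≡0 = d≡0
    ... | no d≢0 = ⊥-elim (<⇒≱ (ascents⇒a< 0 d (n≢0⇒n>0 d≢0) (<⇒≤ d<m) ascs-below)
                                (≤-trans a[d]≤a[d+2] (≤-trans a[d+2]≤a[m′] a[m′]≤a[0])))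
    m′≡2 : m′ ≡ 2
    m′≡2 with m≤n⇒m<n∨m≡n d+1<m′
    ... | inj₂ d+2≡m′ = trans (sym d+2≡m′) (cong (2 +_) d≡0)
    ... | inj₁ d+2<m′ = ⊥-elim (<⇒≱ (ascents⇒a< (2 + d) m′ d+2<m′ (n≤1+n m′) ascs-above)
                          (≤-trans a[m′]≤a[0] (≤-trans (ascents⇒a≤ 0 d z≤n (<⇒≤ d<m) ascs-below) a[d]≤a[d+2])))

  no-triangle : m′ ≢ 1
  no-triangle refl with unique-descent z<s
  ... | zero , _ , ¬asc , ascs =
    <⇒≱ (a<a′ closing-crosses) (<⇒≤ (proj₂ (descent-ascent 0 ≤-refl ¬asc (ascs 1 ≤-refl (λ ())))))
  ... | suc zero , _ , ¬asc , ascs = <-asym l₀<lₘ (proj₁ (ascent-descent 0 ≤-refl (ascs 0 z<s (λ ())) ¬asc))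
  ... | suc (suc _) , s≤s (s≤s ()) , _

  M[]-nested : ∀ j h → j ≢ h → R j ⊑ R h → M[ j , h ] ≡ ∣ R j ∣ʳ
  M[]-nested j h j≢h R[j]⊑R[h] with <-cmp j h
  ... | tri< j<h _ _ = trans (Mᴺ-≤ R j h (<⇒≤ j<h)) (M-⊑ (R j) (R h) R[j]⊑R[h])
  ... | tri≈ _ j≡h _ = ⊥-elim (j≢h j≡h)
  ... | tri> _ _ h<j = trans (Mᴺ-> R j h h<j) (M-⊒ (R h) (R j) R[j]⊑R[h])

  ascents⇒M≡0 : ∀ i j → i < j → j ≤ m → AscentsOn i j → M[ i , j ] ≡ 0
  ascents⇒M≡0 i j i<j j≤m ascs = begin
    M[ i , j ]       ≡⟨ Mᴺ-≤ R i j (<⇒≤ i<j) ⟩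
    M (R i) (R j)    ≡⟨ M-≤-≤ (R i) (R j) (<⇒≤ (<-≤-trans (row-nonempty i (≤-trans (<⇒≤ i<j) j≤m)) a[i]≤b[j]))
                                         (≤-trans a[i]≤b[j] (<⇒≤ (row-nonempty j j≤m))) ⟩
    a[ i ] ∸ b[ j ]  ≡⟨ m≤n⇒m∸n≡0 a[i]≤b[j] ⟩
    0                ∎
    where
    open ≡-Reasoning
    a[i]≤b[j] : a[ i ] ≤ b[ j ]
    a[i]≤b[j] = ascents⇒a≤b i j i<j j≤m ascs

  tiles-sum : ∀ h lo len → lo + len ≤ m → AscentsOn lo (lo + len) →
              (∀ j → lo ≤ j → j < lo + len → j ≢ h × R j ⊑ R h) →
              b[ lo ] + sum (map (λ j → M[ j , h ]) (segment lo len)) ≡ b[ lo + len ]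
  tiles-sum h lo len bound ascs nested-in-h = telescope b[_] (λ j → M[ j , h ]) lo len λ j lo≤j j< →
    let j≢h , R[j]⊑R[h] = nested-in-h j lo≤j j< in begin
      b[ j ] + M[ j , h ]  ≡⟨ cong (b[ j ] +_) (M[]-nested j h j≢h R[j]⊑R[h]) ⟩
      b[ j ] + ∣ R j ∣ʳ    ≡⟨ m+[n∸m]≡n (<⇒≤ (row-nonempty j (≤-trans (<⇒≤ j<) bound))) ⟩
      a[ j ]               ≡⟨ ascent-adjacent j (<-≤-trans j< bound) (ascs j lo≤j j<) ⟩
      b[ suc j ]           ∎
    where open ≡-Reasoning

  exact-cover : ∀ h s → h ≤ m → b[ h ] + s ≡ suc a[ h ] → ∣ R h ∣ʳ + 1 ≤ s
  exact-cover h s h≤m b+s≡1+a = ≤-reflexive (begin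
    ∣ R h ∣ʳ + 1         ≡⟨ suc-∸ (<⇒≤ (row-nonempty h h≤m)) ⟨
    suc a[ h ] ∸ b[ h ]  ≡⟨ cong (_∸ b[ h ]) b+s≡1+a ⟨
    b[ h ] + s ∸ b[ h ]  ≡⟨ m+n∸m≡n b[ h ] s ⟩
    s                    ∎)
    where open ≡-Reasoning

-- Strict runs

record StrictRun (m : ℕ) (R : ℕ → Row) (lo len : ℕ) : Set where
  field
    h          : ℕ
    h≤m        : h ≤ m
    outside    : h < lo ⊎ lo + len ≤ h
    2≤len      : 2 ≤ len
    lo+len≤1+m : lo + len ≤ suc m
    disjoint   : ∀ i j → lo ≤ i → i < j → j < lo + len → Mᴺ R i j ≡ 0
    meets      : All (λ j → 0 < Mᴺ R j h) (segment lo len)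
    covers     : ∣ R h ∣ʳ + 1 ≤ sum (map (λ j → Mᴺ R j h) (segment lo len))

module Classification {k : ℕ} {R : ℕ → Row} (C : NonStrictCycle (3 + k) R) where

  open NonStrictCycle C
  open NonStrictCycleProperties C

  m′ : ℕ
  m′ = 2 + k

  module FinalDescent (ascs : AscentsOn 0 m′) (¬asc : ¬ Ascent m′) where

    down : Crosses (R m) (R m′)
    down = descent-crosses m′ (n<1+n m′) ¬asc

    tiles-disjoint : ∀ i j → i < j → j ≤ m′ → M[ i , j ] ≡ 0
    tiles-disjoint i j i<j j≤m′ =
      ascents⇒M≡0 i j i<j (m≤n⇒m≤1+n j≤m′) λ y _ y<j → ascs y z≤n (<-≤-trans y<j j≤m′)

    R[j]⊑R[m] : ∀ j → 1 ≤ j → j < m′ → R j ⊑ R m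
    R[j]⊑R[m] j 1≤j j<m′ = nested
      (≤-trans (b′≤a closing-crosses) (ascents⇒a≤b 0 j 1≤j (<⇒≤ (m<n⇒m<1+n j<m′)) λ y _ y<j → ascs y z≤n (<-trans y<j j<m′)))
      (≤-trans (ascents⇒a≤b j m′ j<m′ (n≤1+n m′) λ y _ y<m′ → ascs y z≤n y<m′) (b′≤a down))

    M[m′,m]≡ : M[ m′ , m ] ≡ suc a[ m ] ∸ b[ m′ ]
    M[m′,m]≡ = trans (Mᴺ-≤ R m′ m (n≤1+n m′)) (M->-> (R m′) (R m) (b<b′ down) (a<a′ down))

    tail-sum : b[ 1 ] + sum (map (λ j → M[ j , m ]) (segment 1 m′)) ≡ suc a[ m ]
    tail-sum = begin
      b[ 1 ] + sum (map (λ j → M[ j , m ]) (segment 1 m′))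
        ≡⟨ cong (b[ 1 ] +_) (sum-segment-snoc (λ j → M[ j , m ]) 1 (suc k)) ⟩
      b[ 1 ] + (sum (map (λ j → M[ j , m ]) (segment 1 (suc k))) + M[ m′ , m ])
        ≡⟨ +-chain b[ 1 ] _ middle last-step ⟩
      suc a[ m ] ∎
      where
      open ≡-Reasoning
      middle : b[ 1 ] + sum (map (λ j → M[ j , m ]) (segment 1 (suc k))) ≡ b[ m′ ]
      middle = tiles-sum m 1 (suc k) (n≤1+n m′) (λ y 1≤y y<m′ → ascs y z≤n y<m′)
        λ j 1≤j j<m′ → (λ j≡m → <-asym j<m′ (subst (m′ <_) (sym j≡m) (n<1+n m′))) , R[j]⊑R[m] j 1≤j j<m′
      last-step : b[ m′ ] + M[ m′ , m ] ≡ suc a[ m ]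
      last-step = trans (cong (b[ m′ ] +_) M[m′,m]≡) (m+[n∸m]≡n (m≤n⇒m≤1+n (b′≤a down)))

    meets-tail : All (λ j → 0 < M[ j , m ]) (segment 1 m′)
    meets-tail = subst (All (λ j → 0 < M[ j , m ])) (sym (segment-snoc 1 (suc k)))
      (All.++⁺ (All-segment 1 (suc k) λ j 1≤j j<m′ →
              subst (0 <_) (sym (M[]-nested j m (λ j≡m → <-asym j<m′ (subst (m′ <_) (sym j≡m) (n<1+n m′))) (R[j]⊑R[m] j 1≤j j<m′)))
                    (m<n⇒0<n∸m (row-nonempty j (<⇒≤ (m<n⇒m<1+n j<m′)))))
           (subst (0 <_) (sym M[m′,m]≡) (m<n⇒0<n∸m (s≤s (b′≤a down))) ∷ []))

    final-descent : StrictRun m R 0 m ⊎ StrictRun m R 1 m′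
    final-descent = by-overlap (b[ m ] <? a[ 0 ])
      where
      by-overlap : Dec (b[ m ] < a[ 0 ]) → StrictRun m R 0 m ⊎ StrictRun m R 1 m′
      by-overlap (yes b[m]<a[0]) = inj₁ (record
        { h = m ; h≤m = ≤-refl ; outside = inj₂ ≤-refl ; 2≤len = s≤s (s≤s z≤n) ; lo+len≤1+m = n≤1+n m
        ; disjoint = λ i j _ i<j j<m → tiles-disjoint i j i<j (m<1+n⇒m≤n j<m)
        ; meets = subst (0 <_) (sym M[0,m]≡) (m<n⇒0<n∸m b[m]<a[0]) ∷ meets-tail
        ; covers = exact-cover m _ ≤-refl (+-chain b[ m ] M[ 0 , m ] first-step tail-sum) })
        where
        M[0,m]≡ : M[ 0 , m ] ≡ a[ 0 ] ∸ b[ m ]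
        M[0,m]≡ = trans (Mᴺ-≤ R 0 m z≤n) (M-≤-≤ (R 0) (R m) (<⇒≤ l₀<lₘ) (<⇒≤ (a<a′ closing-crosses)))
        first-step : b[ m ] + M[ 0 , m ] ≡ b[ 1 ]
        first-step = begin
          b[ m ] + M[ 0 , m ]        ≡⟨ cong (b[ m ] +_) M[0,m]≡ ⟩
          b[ m ] + (a[ 0 ] ∸ b[ m ]) ≡⟨ m+[n∸m]≡n (b′≤a closing-crosses) ⟩
          a[ 0 ]                     ≡⟨ ascent-adjacent 0 z<s (ascs 0 z≤n z<s) ⟩
          b[ 1 ]                     ∎
          where open ≡-Reasoning
      by-overlap (no b[m]≮a[0]) = inj₂ (record
        { h = m ; h≤m = ≤-refl ; outside = inj₂ ≤-refl ; 2≤len = s≤s (s≤s z≤n) ; lo+len≤1+m = n≤1+n m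
        ; disjoint = λ i j _ i<j j<m → tiles-disjoint i j i<j (m<1+n⇒m≤n j<m)
        ; meets = meets-tail
        ; covers = exact-cover m _ ≤-refl
                     (subst (λ x → x + sum (map (λ j → M[ j , m ]) (segment 1 m′)) ≡ suc a[ m ]) (sym b[m]≡b[1]) tail-sum) })
        where
        b[m]≡b[1] : b[ m ] ≡ b[ 1 ]
        b[m]≡b[1] = trans (≤-antisym (b′≤a closing-crosses) (≮⇒≥ b[m]≮a[0])) (ascent-adjacent 0 z<s (ascs 0 z≤n z<s))

  module InitialDescent (¬asc : ¬ Ascent 0) (ascs : AscentsOn 1 m) where

    down : Crosses (R 1) (R 0)
    down = descent-crosses 0 z<s ¬asc

    tiles-disjoint : ∀ i j → 1 ≤ i → i < j → j ≤ m → M[ i , j ] ≡ 0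
    tiles-disjoint i j 1≤i i<j j≤m =
      ascents⇒M≡0 i j i<j j≤m λ y i≤y y<j → ascs y (≤-trans 1≤i i≤y) (<-≤-trans y<j j≤m)

    R[j]⊑R[0] : ∀ j → 2 ≤ j → j < m → R j ⊑ R 0
    R[j]⊑R[0] j 2≤j j<m = nested
      (≤-trans (b′≤a down) (ascents⇒a≤b 1 j 2≤j (<⇒≤ j<m) λ y 1≤y y<j → ascs y 1≤y (<-trans y<j j<m)))
      (≤-trans (ascents⇒a≤b j m j<m ≤-refl λ y j≤y y<m → ascs y (≤-trans (<⇒≤ 2≤j) j≤y) y<m) (b′≤a closing-crosses))

    M[1,0]≡ : M[ 1 , 0 ] ≡ suc a[ 1 ] ∸ b[ 0 ]
    M[1,0]≡ = trans (Mᴺ-> R 1 0 z<s) (M->-> (R 0) (R 1) (b<b′ down) (a<a′ down))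

    first-step : b[ 0 ] + M[ 1 , 0 ] ≡ suc b[ 2 ]
    first-step = begin
      b[ 0 ] + M[ 1 , 0 ]            ≡⟨ cong (b[ 0 ] +_) M[1,0]≡ ⟩
      b[ 0 ] + (suc a[ 1 ] ∸ b[ 0 ]) ≡⟨ m+[n∸m]≡n (m≤n⇒m≤1+n (b′≤a down)) ⟩
      suc a[ 1 ]                     ≡⟨ cong suc (ascent-adjacent 1 (s≤s z<s) (ascs 1 ≤-refl (s≤s z<s))) ⟩
      suc b[ 2 ]                     ∎
      where open ≡-Reasoning

    middle : b[ 2 ] + sum (map (λ j → M[ j , 0 ]) (segment 2 (suc k))) ≡ b[ m ]
    middle = tiles-sum 0 2 (suc k) ≤-refl (λ y 2≤y y<m → ascs y (<⇒≤ 2≤y) y<m)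
      λ j 2≤j j<m → (λ j≡0 → <⇒≢ (<-trans z<s 2≤j) (sym j≡0)) , R[j]⊑R[0] j 2≤j j<m

    M[1,0]>0 : 0 < M[ 1 , 0 ]
    M[1,0]>0 = subst (0 <_) (sym M[1,0]≡) (m<n⇒0<n∸m (s≤s (b′≤a down)))

    meets-middle : All (λ j → 0 < M[ j , 0 ]) (segment 2 (suc k))
    meets-middle = All-segment 2 (suc k) λ j 2≤j j<m →
      subst (0 <_) (sym (M[]-nested j 0 (λ j≡0 → <⇒≢ (<-trans z<s 2≤j) (sym j≡0)) (R[j]⊑R[0] j 2≤j j<m)))
            (m<n⇒0<n∸m (row-nonempty j (<⇒≤ j<m)))

    initial-descent : StrictRun m R 1 m′ ⊎ StrictRun m R 1 m
    initial-descent = by-overlap (b[ m ] <? a[ 0 ])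
      where
      by-overlap : Dec (b[ m ] < a[ 0 ]) → StrictRun m R 1 m′ ⊎ StrictRun m R 1 m
      by-overlap (yes b[m]<a[0]) = inj₂ (record
        { h = 0 ; h≤m = z≤n ; outside = inj₁ z<s ; 2≤len = s≤s (s≤s z≤n) ; lo+len≤1+m = ≤-refl
        ; disjoint = λ i j 1≤i i<j j≤m → tiles-disjoint i j 1≤i i<j (m<1+n⇒m≤n j≤m)
        ; meets = M[1,0]>0 ∷ subst (All (λ j → 0 < M[ j , 0 ])) (sym (segment-snoc 2 (suc k)))
                                   (All.++⁺ meets-middle (subst (0 <_) (sym M[m,0]≡) (m<n⇒0<n∸m b[m]<a[0]) ∷ []))
        ; covers = exact-cover 0 _ z≤n (+-chain b[ 0 ] M[ 1 , 0 ] first-step (begin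
            suc b[ 2 ] + sum (map (λ j → M[ j , 0 ]) (segment 2 m′))
              ≡⟨ cong (suc b[ 2 ] +_) (sum-segment-snoc (λ j → M[ j , 0 ]) 2 (suc k)) ⟩
            suc b[ 2 ] + (sum (map (λ j → M[ j , 0 ]) (segment 2 (suc k))) + M[ m , 0 ])
              ≡⟨ +-chain (suc b[ 2 ]) _ (cong suc middle) last-step ⟩
            suc a[ 0 ] ∎)) })
        where
        open ≡-Reasoning
        M[m,0]≡ : M[ m , 0 ] ≡ a[ 0 ] ∸ b[ m ]
        M[m,0]≡ = trans (Mᴺ-> R m 0 z<s) (M-≤-≤ (R 0) (R m) (<⇒≤ l₀<lₘ) (<⇒≤ (a<a′ closing-crosses)))
        last-step : suc b[ m ] + M[ m , 0 ] ≡ suc a[ 0 ]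
        last-step = cong suc (trans (cong (b[ m ] +_) M[m,0]≡) (m+[n∸m]≡n (<⇒≤ b[m]<a[0])))
      by-overlap (no b[m]≮a[0]) = inj₁ (record
        { h = 0 ; h≤m = z≤n ; outside = inj₁ z<s ; 2≤len = s≤s (s≤s z≤n) ; lo+len≤1+m = n≤1+n m
        ; disjoint = λ i j 1≤i i<j j<m → tiles-disjoint i j 1≤i i<j (<⇒≤ j<m)
        ; meets = M[1,0]>0 ∷ meets-middle
        ; covers = exact-cover 0 _ z≤n (+-chain b[ 0 ] M[ 1 , 0 ] first-step (cong suc (trans middle b[m]≡a[0]))) })
        where
        b[m]≡a[0] : b[ m ] ≡ a[ 0 ]
        b[m]≡a[0] = ≤-antisym (b′≤a closing-crosses) (≮⇒≥ b[m]≮a[0])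

module _ {R : ℕ → Row} (C : NonStrictCycle 3 R) where

  open NonStrictCycle C
  open NonStrictCycleProperties C

  square : Ascent 0 → ¬ Ascent 1 → Ascent 2 → Case2 4 (R ∘ toℕ)
  square asc₀ ¬asc₁ asc₂ =
    b₁≡b₃ , trans (cong ℤ.+_ b₃≡a₀) (sym (r+1≡a (R 0))) ,
    trans (r+1≡a (R 0)) (trans (cong ℤ.+_ a₀≡a₂) (sym (r+1≡a (R 2)))) ,
    (M₁₃≡∣R₃∣ , λ M₁₃≡∣R₁∣ → <⇒≢ ∣R₃∣<∣R₁∣ (trans (sym M₁₃≡∣R₃∣) M₁₃≡∣R₁∣)) ,
    (M₀₂≡∣R₀∣ , λ M₀₂≡∣R₂∣ → <⇒≢ ∣R₀∣<∣R₂∣ (trans (sym M₀₂≡∣R₀∣) M₀₂≡∣R₂∣))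
    where
    ad : b[ 2 ] < b[ 0 ] × R 0 ⊑ R 2
    ad = ascent-descent 0 (s≤s (s≤s z≤n)) asc₀ ¬asc₁
    da : R 3 ⊑ R 1 × a[ 3 ] < a[ 1 ]
    da = descent-ascent 1 ≤-refl ¬asc₁ asc₂
    a₀≡a₂ : a[ 0 ] ≡ a[ 2 ]
    a₀≡a₂ = ≤-antisym (a≤a′ (proj₂ ad))
                      (≤-trans (≤-reflexive (ascent-adjacent 2 ≤-refl asc₂)) (b′≤a closing-crosses))
    b₃≡a₀ : b[ 3 ] ≡ a[ 0 ]
    b₃≡a₀ = trans (sym (ascent-adjacent 2 ≤-refl asc₂)) (sym a₀≡a₂)
    b₁≡b₃ : b[ 1 ] ≡ b[ 3 ]
    b₁≡b₃ = trans (sym (ascent-adjacent 0 z<s asc₀)) (sym b₃≡a₀)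
    M₁₃≡∣R₃∣ : M (R 1) (R 3) ≡ ∣ R 3 ∣ʳ
    M₁₃≡∣R₃∣ = M-⊒ (R 1) (R 3) (proj₁ da)
    ∣R₃∣<∣R₁∣ : ∣ R 3 ∣ʳ < ∣ R 1 ∣ʳ
    ∣R₃∣<∣R₁∣ = subst (λ x → ∣ R 3 ∣ʳ < a[ 1 ] ∸ x) (sym b₁≡b₃)
                      (∸-monoˡ-< (proj₂ da) (<⇒≤ (row-nonempty 3 ≤-refl)))
    M₀₂≡∣R₀∣ : M (R 0) (R 2) ≡ ∣ R 0 ∣ʳ
    M₀₂≡∣R₀∣ = M-⊑ (R 0) (R 2) (proj₂ ad)
    ∣R₀∣<∣R₂∣ : ∣ R 0 ∣ʳ < ∣ R 2 ∣ʳ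
    ∣R₀∣<∣R₂∣ = subst (λ x → ∣ R 0 ∣ʳ < x ∸ b[ 2 ]) a₀≡a₂
                      (∸-monoʳ-< (proj₁ ad) (<⇒≤ (row-nonempty 0 z≤n)))

Outcome : ℕ → (ℕ → Row) → Set
Outcome m R = (StrictRun m R 0 m ⊎ StrictRun m R 1 (m ∸ 1) ⊎ StrictRun m R 1 m)
              ⊎ (m ≡ 3 × Case2 4 (R ∘ toℕ))

classify : ∀ k {R} → NonStrictCycle (3 + k) R → Outcome (3 + k) R
classify k C with unique-descent z<s
  where open NonStrictCycleProperties C
... | zero , _ , ¬asc , ascs =
  inj₁ (inj₂ (InitialDescent.initial-descent ¬asc λ y 1≤y y<m → ascs y y<m (λ y≡0 → <⇒≢ 1≤y (sym y≡0))))
  where open Classification C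
... | suc d , d<m , ¬asc , ascs with suc d ≟ 2 + k
  where open NonStrictCycleProperties C
...   | yes refl =
  inj₁ (map₂ inj₁ (FinalDescent.final-descent (λ y _ y<m′ → ascs y (m<n⇒m<1+n y<m′) (<⇒≢ y<m′)) ¬asc))
  where open Classification C
...   | no d+1≢m′ with inner-descent-position (suc d) z<s (≤∧≢⇒< (m<1+n⇒m≤n d<m) d+1≢m′) ¬asc ascs
  where open NonStrictCycleProperties C
...     | refl , refl = inj₂ (refl , square C (ascs 0 z<s (λ ())) ¬asc (ascs 2 ≤-refl (λ ())))

-- Back to rows indexed by Fin

-- ι m i is i as an index into m + 1 rows; the junk value 0 for i > m is never used.
ι : ∀ m → ℕ → Fin (suc m)
ι m i with i <? suc m
... | yes i<1+m = fromℕ< i<1+m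
... | no _      = Fin.zero

toℕ-ι : ∀ {m i} → i ≤ m → toℕ (ι m i) ≡ i
toℕ-ι {m} {i} i≤m with i <? suc m
... | yes i<1+m = toℕ-fromℕ< i<1+m
... | no i≮1+m  = ⊥-elim (i≮1+m (s≤s i≤m))

ι-toℕ : ∀ {m} (i : Fin (suc m)) → ι m (toℕ i) ≡ i
ι-toℕ i = toℕ-injective (toℕ-ι (≤-pred (toℕ<n i)))

ι-mono : ∀ {m i j} → i < j → j ≤ m → ι m i Fin.< ι m j
ι-mono i<j j≤m = subst₂ _<_ (sym (toℕ-ι (<⇒≤ (<-≤-trans i<j j≤m)))) (sym (toℕ-ι j≤m)) i<j

allFin-ι : ∀ m → allFin (suc m) ≡ map (ι m) (segment 0 (suc m))
allFin-ι m = trans (tabulate-cong (sym ∘ ι-toℕ)) (tabulate-segment (ι m) (suc m) 0)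

range-ι : ∀ {m p q} → p ≤ q → q ≤ m → range (suc m) p q ≡ map (ι m) (segment p (suc q ∸ p))
range-ι {m} {p} {q} p≤q q≤m = trans (cong (filter P?) split) (filter-middle P? before within after)
  where
  P? : Decidable (λ (i : Fin (suc m)) → p ≤ toℕ i × toℕ i ≤ q)
  P? i = (p ≤? toℕ i) ×-dec (toℕ i ≤? q)
  len rest : ℕ
  len  = suc q ∸ p
  rest = m ∸ q
  p+len≡1+q : p + len ≡ suc q
  p+len≡1+q = m+[n∸m]≡n (m≤n⇒m≤1+n p≤q)
  1+m≡ : suc m ≡ p + (len + rest)
  1+m≡ = sym (trans (sym (+-assoc p len rest)) (trans (cong (_+ rest) p+len≡1+q) (cong suc (m+[n∸m]≡n q≤m))))
  split : allFin (suc m) ≡ map (ι m) (segment 0 p) ++ map (ι m) (segment p len) ++ map (ι m) (segment (p + len) rest)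
  split = begin
    allFin (suc m)                                                 ≡⟨ allFin-ι m ⟩
    map (ι m) (segment 0 (suc m))                                  ≡⟨ cong (map (ι m) ∘ segment 0) 1+m≡ ⟩
    map (ι m) (segment 0 (p + (len + rest)))                       ≡⟨ cong (map (ι m)) (segment-++ 0 p (len + rest)) ⟩
    map (ι m) (segment 0 p ++ segment p (len + rest))              ≡⟨ cong (map (ι m) ∘ (segment 0 p ++_)) (segment-++ p len rest) ⟩
    map (ι m) (segment 0 p ++ segment p len ++ segment (p + len) rest)
      ≡⟨ trans (map-++ (ι m) (segment 0 p) _) (cong (map (ι m) (segment 0 p) ++_) (map-++ (ι m) (segment p len) _)) ⟩
    map (ι m) (segment 0 p) ++ map (ι m) (segment p len) ++ map (ι m) (segment (p + len) rest) ∎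
    where open ≡-Reasoning
  before : All (λ i → ¬ (p ≤ toℕ i × toℕ i ≤ q)) (map (ι m) (segment 0 p))
  before = All.map⁺ (All-segment 0 p λ j _ j<p (p≤j , _) →
             <⇒≱ j<p (subst (p ≤_) (toℕ-ι (≤-trans (<⇒≤ j<p) (≤-trans p≤q q≤m))) p≤j))
  within : All (λ i → p ≤ toℕ i × toℕ i ≤ q) (map (ι m) (segment p len))
  within = All.map⁺ (All-segment p len λ j p≤j j< →
             let j≤q = m<1+n⇒m≤n (subst (j <_) p+len≡1+q j<) ; toℕ-ι-j = toℕ-ι (≤-trans j≤q q≤m)
             in subst (p ≤_) (sym toℕ-ι-j) p≤j , subst (_≤ q) (sym toℕ-ι-j) j≤q)
  after : All (λ i → ¬ (p ≤ toℕ i × toℕ i ≤ q)) (map (ι m) (segment (p + len) rest))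
  after = All.map⁺ (All-segment (p + len) rest λ j q<j j< (_ , j≤q) →
            <⇒≱ (subst (_≤ j) p+len≡1+q q<j)
                (subst (_≤ q) (toℕ-ι (m<1+n⇒m≤n (subst (j <_) (sym 1+m≡) (subst (j <_) (+-assoc p len rest) j<)))) j≤q))

module Reindexing {m : ℕ} (R : Fin (suc m) → Row) where

  Rᴺ : ℕ → Row
  Rᴺ = R ∘ ι m

  Mˢ-ι : ∀ {i j} → i ≤ m → j ≤ m → Mˢ R (ι m i) (ι m j) ≡ Mᴺ Rᴺ i j
  Mˢ-ι {i} {j} i≤m j≤m =
    cong₂ (λ x y → if does (x ≤? y) then M (Rᴺ i) (Rᴺ j) else M (Rᴺ j) (Rᴺ i)) (toℕ-ι i≤m) (toℕ-ι j≤m)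

  tabulate-Rᴺ : tabulate R ≡ map Rᴺ (segment 0 (suc m))
  tabulate-Rᴺ = trans (tabulate-cong (λ i → cong R (sym (ι-toℕ i)))) (tabulate-segment Rᴺ (suc m) 0)

  edge-¬commute : NCPath (tabulate R) → ∀ t → t < m → ¬ Commute (Rᴺ t) (Rᴺ (suc t))
  edge-¬commute (_ , linked) t t<m =
    Linked-segment⁻ 0 (suc m) (Linked.map⁻ (subst (Linked _) tabulate-Rᴺ linked)) t z≤n (s≤s t<m)

  shortcut : ℕ → ℕ → List ℕ
  shortcut i j = segment 0 (suc i) ++ segment j (suc (m ∸ j))

  module _ {i j : ℕ} (i+2≤j : 2 + i ≤ j) (j≤m : j ≤ m) where

    linked-shortcut : ∀ {Q : ℕ → ℕ → Set} → (∀ t → t < m → Q t (suc t)) → Q i j → Linked Q (shortcut i j)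
    linked-shortcut {Q} step jump = Linked.++⁺
      (Linked-segment 0 (suc i) λ t _ t+1<1+i → step t (<-trans (<-pred t+1<1+i) i<m))
      (subst (λ x → Connected Q x (just j)) (sym (last-segment 0 i)) (just jump))
      (Linked-segment j (suc (m ∸ j)) λ t _ t+1< → step t (≤-pred (subst (suc t <_) j+1+[m∸j]≡1+m t+1<)))
      where
      i<m : i < m
      i<m = <-≤-trans (<-trans (n<1+n i) (n<1+n (suc i))) (≤-trans i+2≤j j≤m)
      j+1+[m∸j]≡1+m : j + suc (m ∸ j) ≡ suc m
      j+1+[m∸j]≡1+m = trans (+-suc j (m ∸ j)) (cong suc (m+[n∸m]≡n j≤m))

    last-shortcut : Maybe.map toℕ (last (map (ι m) (shortcut i j))) ≡ just (suc m ∸ 1)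
    last-shortcut = begin
      Maybe.map toℕ (last (map (ι m) (shortcut i j)))
        ≡⟨ cong (Maybe.map toℕ) (last-map (ι m) (shortcut i j)) ⟩
      Maybe.map toℕ (Maybe.map (ι m) (last (shortcut i j)))
        ≡⟨ cong (Maybe.map toℕ ∘ Maybe.map (ι m)) (last-++ (segment 0 (suc i)) j _) ⟩
      Maybe.map toℕ (Maybe.map (ι m) (last (segment j (suc (m ∸ j)))))
        ≡⟨ cong (Maybe.map toℕ ∘ Maybe.map (ι m)) (last-segment j (m ∸ j)) ⟩
      just (toℕ (ι m (j + (m ∸ j)))) ≡⟨ cong (just ∘ toℕ ∘ ι m) (m+[n∸m]≡n j≤m) ⟩
      just (toℕ (ι m m))             ≡⟨ cong just (toℕ-ι ≤-refl) ⟩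
      just m                         ∎
      where open ≡-Reasoning

    length-shortcut : length (map (ι m) (shortcut i j)) ≡ suc i + suc (m ∸ j)
    length-shortcut = trans (length-map (ι m) (shortcut i j)) (trans (length-++ (segment 0 (suc i)))
                        (cong₂ _+_ (length-segment 0 (suc i)) (length-segment j (suc (m ∸ j)))))

    length-shortcut< : length (map (ι m) (shortcut i j)) < suc m
    length-shortcut< = s≤s (subst (_≤ m) (sym length-shortcut) (begin
      suc i + suc (m ∸ j) ≡⟨ cong suc (+-suc i (m ∸ j)) ⟩
      2 + i + (m ∸ j)     ≤⟨ +-monoˡ-≤ (m ∸ j) i+2≤j ⟩
      j + (m ∸ j)         ≡⟨ m+[n∸m]≡n j≤m ⟩
      m                   ∎))
      where open ≤-Reasoning

    3≤length-shortcut : ¬ (i ≡ 0 × j ≡ m) → 3 ≤ length (map (ι m) (shortcut i j))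
    3≤length-shortcut ¬closing = subst (3 ≤_) (sym length-shortcut) (at-least-three i ¬closing)
      where
      at-least-three : ∀ i → ¬ (i ≡ 0 × j ≡ m) → 3 ≤ suc i + suc (m ∸ j)
      at-least-three zero    ¬closing = s≤s (s≤s (m<n⇒0<n∸m (≤∧≢⇒< j≤m λ j≡m → ¬closing (refl , j≡m))))
      at-least-three (suc i) _        = s≤s (s≤s (≤-trans (s≤s z≤n) (m≤n+m (suc (m ∸ j)) i)))

  -- A noncommuting chord (i, j) would make R 0, …, R i, R j, …, R m a shorter noncommuting path.
  chord-commute : NCPath (tabulate R) → Minimal R →
                  ∀ i j → 2 + i ≤ j → j ≤ m → ¬ (i ≡ 0 × j ≡ m) → Commute (Rᴺ i) (Rᴺ j)
  chord-commute path minimal i j i+2≤j j≤m ¬closing with M (Rᴺ i) (Rᴺ j) ≟ M (Rᴺ j) (Rᴺ i)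
  ... | yes commute = commute
  ... | no ¬commute = ⊥-elim (minimal (map (ι m) (shortcut i j))
          (Linked.map⁺ (linked-shortcut i+2≤j j≤m (λ t t<m → ι-mono (n<1+n t) t<m) (ι-mono (<-trans (n<1+n i) i+2≤j) j≤m)))
          refl (last-shortcut i+2≤j j≤m) (3≤length-shortcut i+2≤j j≤m ¬closing) (length-shortcut< i+2≤j j≤m)
          (subst (3 ≤_) (sym (length-map R (map (ι m) (shortcut i j)))) (3≤length-shortcut i+2≤j j≤m ¬closing) ,
           Linked.map⁺ (Linked.map⁺ (linked-shortcut i+2≤j j≤m (edge-¬commute path) ¬commute))))

  ι-fromℕ : ι m m ≡ fromℕ m
  ι-fromℕ = toℕ-injective (trans (toℕ-ι ≤-refl) (sym (toℕ-fromℕ m)))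

  module _ (path : NCPath (tabulate R))
           (nonstrict : (t t′ : Fin (suc m)) → toℕ t′ ≡ suc (toℕ t) → ¬ StrictPair R t t′) where

    private
      successor : ∀ {t} → t < m → toℕ (ι m (suc t)) ≡ suc (toℕ (ι m t))
      successor {t} t<m = trans (toℕ-ι t<m) (cong suc (sym (toℕ-ι (<⇒≤ t<m))))

      ι-injective : ∀ {i j} → i ≤ m → j ≤ m → i ≢ j → ι m i ≢ ι m j
      ι-injective i≤m j≤m i≢j ιi≡ιj = i≢j (trans (sym (toℕ-ι i≤m)) (trans (cong toℕ ιi≡ιj) (toℕ-ι j≤m)))

      ascent-crosses : ∀ {t} → t < m → l (Rᴺ t) < l (Rᴺ (suc t)) → Crosses (Rᴺ t) (Rᴺ (suc t))
      ascent-crosses {t} t<m l< = ¬commute⇒crosses l< (edge-¬commute path t t<m)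

      M-ascent : ∀ {t} → t < m → l (Rᴺ t) < l (Rᴺ (suc t)) → Mˢ R (ι m t) (ι m (suc t)) ≡ a (Rᴺ t) ∸ b (Rᴺ (suc t))
      M-ascent {t} t<m l< = trans (Mˢ-ι (<⇒≤ t<m) t<m) (trans (Mᴺ-≤ Rᴺ t (suc t) (n≤1+n t))
        (M-≤-≤ (Rᴺ t) (Rᴺ (suc t)) (<⇒≤ l<) (<⇒≤ (a<a′ (ascent-crosses t<m l<)))))

    ascent-adjacent : ∀ t → t < m → l (Rᴺ t) < l (Rᴺ (suc t)) → a (Rᴺ t) ≡ b (Rᴺ (suc t))
    ascent-adjacent t t<m l< with a (Rᴺ t) ≟ b (Rᴺ (suc t))
    ... | yes adjacent = adjacent
    ... | no ¬adjacent = ⊥-elim (nonstrict (ι m t) (ι m (suc t)) (successor t<m)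
            (ι-mono (n<1+n t) t<m , l< , inj₁ (subst (0 <_) (sym (M-ascent t<m l<)) (m<n⇒0<n∸m b′<a) ,
              subst (_< ∣ Rᴺ t ∣ʳ ⊓ ∣ Rᴺ (suc t) ∣ʳ) (sym (M-ascent t<m l<))
                    (⊓-glb (∸-monoʳ-< l< (b′≤a up)) (∸-monoˡ-< (a<a′ up) (b′≤a up))))))
      where
      up : Crosses (Rᴺ t) (Rᴺ (suc t))
      up = ascent-crosses t<m l<
      b′<a : b (Rᴺ (suc t)) < a (Rᴺ t)
      b′<a = ≤∧≢⇒< (b′≤a up) (λ b≡a → ¬adjacent (sym b≡a))

    ascent-¬covers : ∀ t k → t < m → l (Rᴺ t) < l (Rᴺ (suc t)) → k ≤ m → k ≢ t → k ≢ suc t →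
                     ¬ (∣ Rᴺ k ∣ʳ + 1 ≤ Mᴺ Rᴺ t k + Mᴺ Rᴺ (suc t) k)
    ascent-¬covers t k t<m l< k≤m k≢t k≢t+1 covered = nonstrict (ι m t) (ι m (suc t)) (successor t<m)
      (ι-mono (n<1+n t) t<m , l< , inj₂ (M≡0 , ι m k , ι-injective k≤m (<⇒≤ t<m) k≢t , ι-injective k≤m t<m k≢t+1 ,
        subst₂ (λ x y → ∣ Rᴺ k ∣ʳ + 1 ≤ x + y) (sym (Mˢ-ι (<⇒≤ t<m) k≤m)) (sym (Mˢ-ι t<m k≤m)) covered))
      where
      M≡0 : Mˢ R (ι m t) (ι m (suc t)) ≡ 0
      M≡0 = trans (M-ascent t<m l<) (trans (cong (_∸ b (Rᴺ (suc t))) (ascent-adjacent t t<m l<)) (n∸n≡0 (b (Rᴺ (suc t)))))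

    cycle : Minimal R → l (R Fin.zero) < l (R (fromℕ m)) → ¬ Commute (R Fin.zero) (R (fromℕ m)) → NonStrictCycle m Rᴺ
    cycle minimal l₀<lₘ ¬commute₀ₘ = record
      { edge-¬commute   = edge-¬commute path
      ; chord-commute   = chord-commute path minimal
      ; l₀<lₘ           = subst (λ i → l (R Fin.zero) < l (R i)) (sym ι-fromℕ) l₀<lₘ
      ; ¬commute₀ₘ      = subst (λ i → ¬ Commute (R Fin.zero) (R i)) (sym ι-fromℕ) ¬commute₀ₘ
      ; ascent-adjacent = ascent-adjacent
      ; ascent-¬covers  = ascent-¬covers
      }

  strict-sequence : ∀ {lo len} → StrictRun m Rᴺ lo len → StrictSeq R (map (ι m) (segment lo len))
  strict-sequence {lo} {len} run =
    Linked.map⁺ (Linked-segment lo len λ t lo≤t t+1< → ι-mono (n<1+n t) (in-range (suc t) (m≤n⇒m≤1+n lo≤t) t+1<)) ,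
    subst (2 ≤_) (sym (trans (length-map (ι m) (segment lo len)) (length-segment lo len))) 2≤len ,
    AllPairs.map⁺ (AllPairs-segment lo len λ i j lo≤i i<j j< →
      trans (Mˢ-ι (in-range i lo≤i (<-trans i<j j<)) (in-range j (<⇒≤ (≤-<-trans lo≤i i<j)) j<)) (disjoint i j lo≤i i<j j<)) ,
    ι m h , side outside ,
    All.map⁺ (All.zipWith (λ (0<M , j≤m) → subst (0 <_) (sym (Mˢ-ι j≤m h≤m)) 0<M) (meets , All-segment lo len in-range)) ,
    subst (∣ Rᴺ h ∣ʳ + 1 ≤_) (sym (cong sum (trans (sym (map-∘ (segment lo len)))
      (map-cong-local (All-segment lo len λ j lo≤j j< → Mˢ-ι (in-range j lo≤j j<) h≤m))))) covers
    where
    open StrictRun run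
    in-range : ∀ j → lo ≤ j → j < lo + len → j ≤ m
    in-range j _ j< = m<1+n⇒m≤n (<-≤-trans j< lo+len≤1+m)
    side : h < lo ⊎ lo + len ≤ h →
           All (ι m h Fin.<_) (map (ι m) (segment lo len)) ⊎ All (Fin._< ι m h) (map (ι m) (segment lo len))
    side (inj₁ h<lo)     =
      inj₁ (All.map⁺ (All-segment lo len λ j lo≤j j< → ι-mono (<-≤-trans h<lo lo≤j) (in-range j lo≤j j<)))
    side (inj₂ lo+len≤h) =
      inj₂ (All.map⁺ (All-segment lo len λ j _ j< → ι-mono (<-≤-trans j< lo+len≤h) h≤m))

module _ {k : ℕ} (R : Fin (4 + k) → Row) where

  open Reindexing R

  outcome⇒conclusion : let m = 3 + k in Outcome m Rᴺ →
    (StrictSeq R (range (suc m) 0 (m ∸ 1)) ⊎ StrictSeq R (range (suc m) 1 (m ∸ 1)) ⊎ StrictSeq R (range (suc m) 1 m))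
    ⊎ Case2 (suc m) R
  outcome⇒conclusion (inj₁ (inj₁ run)) =
    inj₁ (inj₁ (subst (StrictSeq R) (sym (range-ι z≤n (n≤1+n _))) (strict-sequence run)))
  outcome⇒conclusion (inj₁ (inj₂ (inj₁ run))) =
    inj₁ (inj₂ (inj₁ (subst (StrictSeq R) (sym (range-ι (s≤s z≤n) (n≤1+n _))) (strict-sequence run))))
  outcome⇒conclusion (inj₁ (inj₂ (inj₂ run))) =
    inj₁ (inj₂ (inj₂ (subst (StrictSeq R) (sym (range-ι (s≤s z≤n) ≤-refl)) (strict-sequence run))))
  -- Case2 4 (Rᴺ ∘ toℕ) is Case2 4 R by computation: ι 3 (toℕ i) reduces to i for each of the four indices.
  outcome⇒conclusion (inj₂ (refl , square)) = inj₂ square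

proposition5p36 : (m : ℕ) (R : Fin (suc m) → Row) →
    NCPath (tabulate R) → Minimal R →
    l (R zero) < l (R (fromℕ m)) →
    ¬ Commute (R zero) (R (fromℕ m)) →
    ((t t′ : Fin (suc m)) → toℕ t′ ≡ suc (toℕ t) → ¬ StrictPair R t t′) →
    (StrictSeq R (range (suc m) 0 (m ∸ 1))
      ⊎ StrictSeq R (range (suc m) 1 (m ∸ 1))
      ⊎ StrictSeq R (range (suc m) 1 m))
    ⊎ Case2 (suc m) R
proposition5p36 0 R (s≤s () , _) _ _ _ _
proposition5p36 1 R (s≤s (s≤s ()) , _) _ _ _ _
proposition5p36 2 R path minimal l₀<lₘ ¬commute₀ₘ nonstrict =
  ⊥-elim (NonStrictCycleProperties.no-triangle (Reindexing.cycle R path nonstrict minimal l₀<lₘ ¬commute₀ₘ) refl)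
proposition5p36 (suc (suc (suc k))) R path minimal l₀<lₘ ¬commute₀ₘ nonstrict =
  outcome⇒conclusion R (classify k (Reindexing.cycle R path nonstrict minimal l₀<lₘ ¬commute₀ₘ))
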